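{- Let $f(n)=\sum_{j=0}^{n}(-1)^{j}S(n,j)$ and let $p$ be an odd prime. Then for all integers $n\ge 0$, $$f(n)\equiv f\Bigl(n+2\,\tfrac{p^{p}-1}{p-1}\Bigr)\pmod p,$$ and for all integers $n\ge 0$ and $h\ge 1$, $$f(n)\equiv f\Bigl(n+\tfrac{2p^{2h-2}(p^{p}-1)}{p-1}\Bigr)\pmod{p^h}.$$
   Context: $S(n,k)$ denotes the Stirling number of the second kind (number of partitions of an $n$-element set into $k$ nonempty blocks, $S(0,0)=1$). -}

module Defs where

open import Data.Nat as ℕ using (ℕ; zero; suc; _∸_; _^_; NonZero)
open import Data.Nat.DivMod using (_/_)
open import Data.Integer as ℤ using (ℤ; +_)
open import Data.Integer.Divisibility using (_∣_)
open import Data.Nat.Primality using (Prime)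

S : ℕ → ℕ → ℕ
S zero    zero    = 1
S zero    (suc k) = 0
S (suc n) zero    = 0
S (suc n) (suc k) = suc k ℕ.* S n (suc k) ℕ.+ S n k

sgn : ℕ → ℤ
sgn zero    = + 1
sgn (suc j) = ℤ.- sgn j

partialSum : ℕ → ℕ → ℤ
partialSum n zero    = sgn 0 ℤ.* + S n 0
partialSum n (suc m) = partialSum n m ℤ.+ sgn (suc m) ℤ.* + S n (suc m)

f : ℕ → ℤ
f n = partialSum n n

_≡_[mod_] : ℤ → ℤ → ℕ → Set
a ≡ b [mod m ] = (+ m) ∣ (a ℤ.- b)

pred-nonZero : (p : ℕ) → Prime p → NonZero (p ∸ 1)
pred-nonZero (suc (suc q)) _ = _

_/[p-1]_ : ℕ → (p : ℕ) → {Prime p} → ℕ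
(x /[p-1] p) {pp} = (x / (p ∸ 1)) {{pred-nonZero p pp}}

{-# OPTIONS --safe #-}
module Submission where

-- Let L be the linear functional on ℤ[x] with L((x)ⱼ) = (−1)ʲ, so that f(n) = L(xⁿ), and let J be the
-- ideal generated by p and g = (x)ₚ + 1. Since S(p, j) ≡ 0 (mod p) for 1 < j < p, we have
-- yᵖ ≡ y + (y)ₚ (mod p) for every polynomial y; with (x − k)ₚ ≡ (x)ₚ (mod p) and (x)ₚ ≡ −1 (mod J)
-- this gives x^(pᵏ) ≡ x − k and x^(1 + p + ⋯ + p^(p−1)) ≡ (x)ₚ (mod J). Hence x^(2N) ≡ 1 (mod J)
-- for N = (pᵖ − 1)/(p − 1), and x^(2N pʲ) ≡ 1 (mod J^(j+1)), since u ≡ 1 (mod J^i) implies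
-- uᵖ − 1 = (u − 1)(1 + u + ⋯ + u^(p−1)) ∈ J^i J.
-- On the other hand L(J^k) ≡ 0 (mod p^⌈k/2⌉): L(x r(x)) = −L(r(x + 1)), so for odd p
-- L(g r) = L(r(x)) − L(r(x + p)), and r(x + p) − r(x) is p times a polynomial one level lower in J.
-- Taking j = 2h − 2 gives the congruence modulo pʰ.

open import Algebra.Bundles using (CommutativeRing)
open import Data.Nat.Base using (ℕ)
open import Data.Nat.Primality using (Prime)
open import Data.Integer.Base using (-1ℤ)
open import Relation.Binary.PropositionalEquality using (_≡_)
open import Defs using (sgn)


module IntegerSums where

  open import Data.Nat.Base as ℕ using (zero; suc; _<_; _≤_; s≤s)
  open import Data.Nat.Properties using (_≟_)
  import Data.Nat.Properties as ℕₚ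
  import Data.Nat.Tactic.RingSolver as ℕ-Solver
  open import Data.Integer.Base using (ℤ; 0ℤ; 1ℤ; _+_; _*_; _-_)
  import Data.Integer.Properties as ℤₚ
  open import Data.Integer.Divisibility.Signed using (_∣_; divides; ∣m∣n⇒∣m+n)
  open import Data.Integer.Tactic.RingSolver using (solve-∀)
  open import Data.Sum.Base using (inj₁; inj₂)
  open import Function.Base using (_⟨_⟩_)
  open import Relation.Binary.PropositionalEquality
  open import Relation.Nullary.Decidable.Core using (yes; no)
  open import Relation.Nullary.Negation.Core using (contradiction)

  ∑< : ℕ → (ℕ → ℤ) → ℤ
  ∑< zero    t = 0ℤ
  ∑< (suc n) t = ∑< n t + t n

  syntax ∑< n (λ j → t) = ∑[ j < n ] t

  ∑-cong : ∀ {t u : ℕ → ℤ} → (∀ j → t j ≡ u j) → ∀ n → ∑< n t ≡ ∑< n u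
  ∑-cong e zero    = refl
  ∑-cong e (suc n) = cong₂ _+_ (∑-cong e n) (e n)

  ∑-distrib-+ : ∀ (t u : ℕ → ℤ) n → ∑[ j < n ] (t j + u j) ≡ ∑< n t + ∑< n u
  ∑-distrib-+ t u zero    = refl
  ∑-distrib-+ t u (suc n) = trans (cong (_+ (t n + u n)) (∑-distrib-+ t u n)) (swap (∑< n t) (∑< n u) (t n) (u n))
    where swap : ∀ a b c d → a + b + (c + d) ≡ a + c + (b + d)
          swap = solve-∀

  ∑-distribˡ-* : ∀ c (t : ℕ → ℤ) n → ∑[ j < n ] (c * t j) ≡ c * ∑< n t
  ∑-distribˡ-* c t zero    = sym (ℤₚ.*-zeroʳ c)
  ∑-distribˡ-* c t (suc n) =
    trans (cong (_+ c * t n) (∑-distribˡ-* c t n)) (sym (ℤₚ.*-distribˡ-+ c (∑< n t) (t n)))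

  δ : ℕ → ℕ → ℤ
  δ a j with a ≟ j
  ... | yes _ = 1ℤ
  ... | no  _ = 0ℤ

  δ-≢ : ∀ {a j} → a ≢ j → δ a j ≡ 0ℤ
  δ-≢ {a} {j} a≢j with a ≟ j
  ... | yes a≡j = contradiction a≡j a≢j
  ... | no  _   = refl

  δ-refl : ∀ a → δ a a ≡ 1ℤ
  δ-refl a with a ≟ a
  ... | yes _   = refl
  ... | no  a≢a = contradiction refl a≢a

  ∑-δ-beyond : ∀ {a} (u : ℕ → ℤ) n → n ≤ a → ∑[ j < n ] (δ a j * u j) ≡ 0ℤ
  ∑-δ-beyond u zero    _   = refl
  ∑-δ-beyond {a} u (suc n) n<a = begin
    ∑[ j < n ] (δ a j * u j) + δ a n * u n
      ≡⟨ cong₂ _+_ (∑-δ-beyond u n (ℕₚ.<⇒≤ n<a)) (cong (_* u n) (δ-≢ (ℕₚ.>⇒≢ n<a))) ⟩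
    0ℤ + 0ℤ * u n
      ≡⟨ cong (_+_ 0ℤ) (ℤₚ.*-zeroˡ (u n)) ⟩
    0ℤ
      ∎
    where open ≡-Reasoning

  ∑-δ : ∀ {a} (u : ℕ → ℤ) n → a < n → ∑[ j < n ] (δ a j * u j) ≡ u a
  ∑-δ {a} u (suc n) (s≤s a≤n) with ℕₚ.m≤n⇒m<n∨m≡n a≤n
  ... | inj₁ a<n  = begin
    ∑[ j < n ] (δ a j * u j) + δ a n * u n
      ≡⟨ cong₂ _+_ (∑-δ u n a<n) (cong (_* u n) (δ-≢ (ℕₚ.<⇒≢ a<n))) ⟩
    u a + 0ℤ * u n
      ≡⟨ cong (_+_ (u a)) (ℤₚ.*-zeroˡ (u n)) ⟨ trans ⟩ ℤₚ.+-identityʳ (u a) ⟩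
    u a
      ∎
    where open ≡-Reasoning
  ... | inj₂ refl = begin
    ∑[ j < a ] (δ a j * u j) + δ a a * u a
      ≡⟨ cong₂ _+_ (∑-δ-beyond u a ℕₚ.≤-refl) (cong (_* u a) (δ-refl a)) ⟩
    0ℤ + 1ℤ * u a
      ≡⟨ ℤₚ.+-identityˡ _ ⟨ trans ⟩ ℤₚ.*-identityˡ (u a) ⟩
    u a
      ∎
    where open ≡-Reasoning

  ∑-δ₂ : ∀ {a b} (u v : ℕ → ℤ) n → a < n → b < n → ∑[ j < n ] (δ a j * u j + δ b j * v j) ≡ u a + v b
  ∑-δ₂ {a} {b} u v n a<n b<n =
    ∑-distrib-+ (λ j → δ a j * u j) (λ j → δ b j * v j) n ⟨ trans ⟩ cong₂ _+_ (∑-δ u n a<n) (∑-δ v n b<n)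

  ∣0ℤ : ∀ {d} → d ∣ 0ℤ
  ∣0ℤ = divides 0ℤ refl

  *-monoˡ-∣ : ∀ c {d x} → d ∣ x → c * d ∣ c * x
  *-monoˡ-∣ c {d} (divides q refl) = divides q (lemma c q d)
    where lemma : ∀ c q d → c * (q * d) ≡ q * (c * d)
          lemma = solve-∀

  δ-pattern : ∀ {d a b} (t u v : ℕ → ℤ) → a ≢ b → t a ≡ u a → t b ≡ v b →
              (∀ j → j ≢ a → j ≢ b → d ∣ t j) → ∀ j → d ∣ t j - (δ a j * u j + δ b j * v j)
  δ-pattern {d} {a} {b} t u v a≢b ta tb rest j with j ≟ a | j ≟ b
  ... | yes refl | _        = subst (d ∣_) (sym vanishes) ∣0ℤ
    where vanishes : t j - (δ j j * u j + δ b j * v j) ≡ 0ℤ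
          vanishes = cong₂ (λ x y → t j - (x * u j + y * v j)) (δ-refl j) (δ-≢ (≢-sym a≢b)) ⟨ trans ⟩
                     cong (_- (1ℤ * u j + 0ℤ * v j)) ta ⟨ trans ⟩ lemma (u j) (v j)
            where lemma : ∀ x y → x - (1ℤ * x + 0ℤ * y) ≡ 0ℤ
                  lemma = solve-∀
  ... | no j≢a   | yes refl = subst (d ∣_) (sym vanishes) ∣0ℤ
    where vanishes : t j - (δ a j * u j + δ j j * v j) ≡ 0ℤ
          vanishes = cong₂ (λ x y → t j - (x * u j + y * v j)) (δ-≢ a≢b) (δ-refl j) ⟨ trans ⟩
                     cong (_- (0ℤ * u j + 1ℤ * v j)) tb ⟨ trans ⟩ lemma (u j) (v j)
            where lemma : ∀ x y → y - (0ℤ * x + 1ℤ * y) ≡ 0ℤ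
                  lemma = solve-∀
  ... | no j≢a   | no j≢b   = subst (d ∣_) (sym unchanged) (rest j j≢a j≢b)
    where unchanged : t j - (δ a j * u j + δ b j * v j) ≡ t j
          unchanged = cong₂ (λ x y → t j - (x * u j + y * v j)) (δ-≢ (≢-sym j≢a)) (δ-≢ (≢-sym j≢b)) ⟨ trans ⟩
                      lemma (t j) (u j) (v j)
            where lemma : ∀ x y z → x - (0ℤ * y + 0ℤ * z) ≡ x
                  lemma = solve-∀

  ∑-congruence : ∀ {d} (t u : ℕ → ℤ) → (∀ j → d ∣ t j - u j) → ∀ n → d ∣ ∑< n t - ∑< n u
  ∑-congruence t u d∣t-u zero    = ∣0ℤ
  ∑-congruence t u d∣t-u (suc n) =
    subst (_∣_ _) (regroup (∑< n t) (∑< n u) (t n) (u n)) (∣m∣n⇒∣m+n (∑-congruence t u d∣t-u n) (d∣t-u n))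
    where regroup : ∀ a b c d → a - b + (c - d) ≡ a + c - (b + d)
          regroup = solve-∀

  ∑-mod-two-terms : ∀ {d a b} (t u v : ℕ → ℤ) n → a < n → b < n → a ≢ b → t a ≡ u a → t b ≡ v b →
                    (∀ j → j ≢ a → j ≢ b → d ∣ t j) → d ∣ ∑< n t - (u a + v b)
  ∑-mod-two-terms {d} t u v n a<n b<n a≢b ta tb rest =
    subst (λ w → d ∣ ∑< n t - w) (∑-δ₂ u v n a<n b<n) (∑-congruence t _ (δ-pattern t u v a≢b ta tb rest) n)

  module _ (c c′ w y : ℕ → ℤ) (c′0 : c′ 0 ≡ w 0 * c 0)
           (c′-suc : ∀ j → c′ (suc j) ≡ w (suc j) * c (suc j) + c j) where

    private
      ∑-pascal-general : ∀ n → ∑[ j < suc n ] (c′ j * y j)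
                               ≡ ∑[ j < n ] (c j * (y (suc j) + w j * y j)) + w n * (c n * y n)
      ∑-pascal-general zero = cong (λ v → 0ℤ + v * y 0) c′0 ⟨ trans ⟩ lemma (w 0) (c 0) (y 0)
        where lemma : ∀ a b x → 0ℤ + a * b * x ≡ 0ℤ + a * (b * x)
              lemma = solve-∀
      ∑-pascal-general (suc n) = begin
        ∑[ j < suc n ] (c′ j * y j) + c′ (suc n) * y (suc n)
          ≡⟨ cong₂ (λ u v → u + v * y (suc n)) (∑-pascal-general n) (c′-suc n) ⟩
        σ + w n * (c n * y n) + (w (suc n) * c (suc n) + c n) * y (suc n)
          ≡⟨ lemma σ (w n) (w (suc n)) (c n) (c (suc n)) (y n) (y (suc n)) ⟩
        σ + c n * (y (suc n) + w n * y n) + w (suc n) * (c (suc n) * y (suc n))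
          ∎
        where
        open ≡-Reasoning
        σ : ℤ
        σ = ∑[ j < n ] (c j * (y (suc j) + w j * y j))
        lemma : ∀ σ w₀ w₁ c₀ c₁ y₀ y₁ → σ + w₀ * (c₀ * y₀) + (w₁ * c₁ + c₀) * y₁
                                         ≡ σ + c₀ * (y₁ + w₀ * y₀) + w₁ * (c₁ * y₁)
        lemma = solve-∀

    ∑-pascal : ∀ n → c (suc n) ≡ 0ℤ →
               ∑[ j < suc (suc n) ] (c′ j * y j) ≡ ∑[ j < suc n ] (c j * (y (suc j) + w j * y j))
    ∑-pascal n top≡0 = begin
      ∑[ j < suc (suc n) ] (c′ j * y j)                             ≡⟨ ∑-pascal-general (suc n) ⟩
      σ + w (suc n) * (c (suc n) * y (suc n))                       ≡⟨ cong (λ v → σ + w (suc n) * (v * y (suc n))) top≡0 ⟩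
      σ + w (suc n) * (0ℤ * y (suc n))                              ≡⟨ lemma σ (w (suc n)) (y (suc n)) ⟩
      σ                                                             ∎
      where
      open ≡-Reasoning
      σ : ℤ
      σ = ∑[ j < suc n ] (c j * (y (suc j) + w j * y j))
      lemma : ∀ σ a b → σ + a * (0ℤ * b) ≡ σ
      lemma = solve-∀

  repunit : ℕ → ℕ → ℕ
  repunit b zero    = 0
  repunit b (suc m) = repunit b m ℕ.+ b ℕ.^ m

  repunit-closed-form : ∀ b m → b ℕ.* repunit (suc b) m ℕ.+ 1 ≡ suc b ℕ.^ m
  repunit-closed-form b zero    = cong (ℕ._+ 1) (ℕₚ.*-zeroʳ b)
  repunit-closed-form b (suc m) =
    regroup b (repunit (suc b) m) (suc b ℕ.^ m) ⟨ trans ⟩ cong (ℕ._+ b ℕ.* suc b ℕ.^ m) (repunit-closed-form b m)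
    where regroup : ∀ b r x → b ℕ.* (r ℕ.+ x) ℕ.+ 1 ≡ b ℕ.* r ℕ.+ 1 ℕ.+ b ℕ.* x
          regroup = ℕ-Solver.solve-∀


module PolynomialOperators where

  open import Algebra.Structures using (IsAbelianGroup; IsCommutativeRing)
  open import Algebra.Solver.Ring.AlmostCommutativeRing using (fromCommutativeRing; _-Raw-AlmostCommutative⟶_)
  import Algebra.Solver.Ring
  import Algebra.Definitions.RawMonoid
  open import Data.Maybe.Base using (Maybe; just; nothing)
  open import Data.Nat.Base using (zero; suc)
  open import Data.Integer.Base using (ℤ; +_; 0ℤ; 1ℤ; -1ℤ; _+_; _*_; -_; _-_)
  open import Data.Integer.Properties using (_≟_) renaming (+-*-commutativeRing to ℤ-commutativeRing)
  import Data.Integer.Properties as ℤₚ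
  open import Data.Integer.Divisibility.Signed using (_∣_; ∣m∣n⇒∣m+n; ∣n⇒∣m*n)
  open import Data.Integer.Tactic.RingSolver using (solve-∀)
  open import Data.Product.Base using (Σ; _,_)
  open import Function.Base using (_∘_; _⟨_⟩_)
  open import Level using (0ℓ)
  open import Relation.Binary.PropositionalEquality
  open import Relation.Nullary.Decidable.Core using (yes; no)
  open IntegerSums

  Seq : Set
  Seq = ℕ → ℤ

  record Linear (F : Seq → Seq) : Set where
    field
      cong-≗ : ∀ {s t} → (∀ m → s m ≡ t m) → ∀ n → F s n ≡ F t n
      linear : ∀ u v s t n → F (λ m → u * s m + v * t m) n ≡ u * F s n + v * F t n

    +-*-homo : ∀ s u t n → F (λ m → s m + u * t m) n ≡ F s n + u * F t n
    +-*-homo s u t n =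
      cong-≗ (λ m → cong (_+ u * t m) (sym (ℤₚ.*-identityˡ (s m)))) n ⟨ trans ⟩
      linear 1ℤ u s t n ⟨ trans ⟩
      cong (_+ u * F t n) (ℤₚ.*-identityˡ (F s n))

    +-homo : ∀ s t n → F (λ m → s m + t m) n ≡ F s n + F t n
    +-homo s t n =
      cong-≗ (λ m → cong (_+_ (s m)) (sym (ℤₚ.*-identityˡ (t m)))) n ⟨ trans ⟩
      +-*-homo s 1ℤ t n ⟨ trans ⟩
      cong (_+_ (F s n)) (ℤₚ.*-identityˡ (F t n))

    *-homo : ∀ u s n → F (λ m → u * s m) n ≡ u * F s n
    *-homo u s n =
      cong-≗ (λ m → sym (lemma u (s m))) n ⟨ trans ⟩ linear u 0ℤ s s n ⟨ trans ⟩ lemma u (F s n)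
      where lemma : ∀ u x → u * x + 0ℤ * x ≡ u * x
            lemma = solve-∀

  ∘-linear : ∀ {F G} → Linear F → Linear G → Linear (F ∘ G)
  ∘-linear {G = G} LF LG = record
    { cong-≗ = λ e → Linear.cong-≗ LF (Linear.cong-≗ LG e)
    ; linear = λ u v s t n →
        Linear.cong-≗ LF (Linear.linear LG u v s t) n ⟨ trans ⟩ Linear.linear LF u v (G s) (G t) n
    }

  infixl 6 _⊹_
  infixl 7 _⊙_

  -- Polynomials act on functionals: a sequence s stands for the linear functional L on ℤ[x] with
  -- L((x)ₙ) = s n, and ⟦ q ⟧ s for r ↦ L(q r). The clause for X is x (x)ₙ = (x)ₙ₊₁ + n (x)ₙ.
  data P : Set where
    X   : P
    C   : ℤ → P
    _⊹_ : P → P → P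
    _⊙_ : P → P → P

  ⟦_⟧ : P → Seq → Seq
  ⟦ X ⟧     s n = s (suc n) + + n * s n
  ⟦ C z ⟧   s n = z * s n
  ⟦ a ⊹ b ⟧ s n = ⟦ a ⟧ s n + ⟦ b ⟧ s n
  ⟦ a ⊙ b ⟧ s n = ⟦ a ⟧ (⟦ b ⟧ s) n

  ⟦⟧-linear : ∀ a → Linear ⟦ a ⟧
  ⟦⟧-linear X = record
    { cong-≗ = λ e n → cong₂ (λ u v → u + + n * v) (e (suc n)) (e n)
    ; linear = λ u v s t n → lemma u v (s (suc n)) (t (suc n)) (+ n) (s n) (t n)
    }
    where lemma : ∀ u v a b k c d → u * a + v * b + k * (u * c + v * d) ≡ u * (a + k * c) + v * (b + k * d)
          lemma = solve-∀
  ⟦⟧-linear (C z) = record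
    { cong-≗ = λ e n → cong (z *_) (e n)
    ; linear = λ u v s t n → lemma z u v (s n) (t n)
    }
    where lemma : ∀ z u v a b → z * (u * a + v * b) ≡ u * (z * a) + v * (z * b)
          lemma = solve-∀
  ⟦⟧-linear (a ⊹ b) = record
    { cong-≗ = λ e n → cong₂ _+_ (A.cong-≗ e n) (B.cong-≗ e n)
    ; linear = λ u v s t n →
        cong₂ _+_ (A.linear u v s t n) (B.linear u v s t n) ⟨ trans ⟩
        lemma u v (⟦ a ⟧ s n) (⟦ a ⟧ t n) (⟦ b ⟧ s n) (⟦ b ⟧ t n)
    }
    where module A = Linear (⟦⟧-linear a)
          module B = Linear (⟦⟧-linear b)
          lemma : ∀ u v a b c d → u * a + v * b + (u * c + v * d) ≡ u * (a + c) + v * (b + d)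
          lemma = solve-∀
  ⟦⟧-linear (a ⊙ b) = ∘-linear (⟦⟧-linear a) (⟦⟧-linear b)

  module ⟦⟧ (a : P) = Linear (⟦⟧-linear a)

  X-comm : ∀ b s n → ⟦ X ⟧ (⟦ b ⟧ s) n ≡ ⟦ b ⟧ (⟦ X ⟧ s) n
  X-comm X       s n = refl
  X-comm (C z)   s n = lemma z (s (suc n)) (+ n) (s n)
    where lemma : ∀ z a k c → z * a + k * (z * c) ≡ z * (a + k * c)
          lemma = solve-∀
  X-comm (a ⊹ b) s n =
    lemma (⟦ a ⟧ s (suc n)) (⟦ b ⟧ s (suc n)) (+ n) (⟦ a ⟧ s n) (⟦ b ⟧ s n) ⟨ trans ⟩
    cong₂ _+_ (X-comm a s n) (X-comm b s n)
    where lemma : ∀ a b k c d → a + b + k * (c + d) ≡ (a + k * c) + (b + k * d)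
          lemma = solve-∀
  X-comm (a ⊙ b) s n = X-comm a (⟦ b ⟧ s) n ⟨ trans ⟩ ⟦⟧.cong-≗ a (X-comm b s) n

  ⟦⟧-comm : ∀ a b s n → ⟦ a ⟧ (⟦ b ⟧ s) n ≡ ⟦ b ⟧ (⟦ a ⟧ s) n
  ⟦⟧-comm X         b s n = X-comm b s n
  ⟦⟧-comm (C z)     b s n = sym (⟦⟧.*-homo b z s n)
  ⟦⟧-comm (a₁ ⊹ a₂) b s n =
    cong₂ _+_ (⟦⟧-comm a₁ b s n) (⟦⟧-comm a₂ b s n) ⟨ trans ⟩ sym (⟦⟧.+-homo b (⟦ a₁ ⟧ s) (⟦ a₂ ⟧ s) n)
  ⟦⟧-comm (a₁ ⊙ a₂) b s n = ⟦⟧.cong-≗ a₁ (⟦⟧-comm a₂ b s) n ⟨ trans ⟩ ⟦⟧-comm a₁ b (⟦ a₂ ⟧ s) n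

  ⟦⟧-preserves-∣ : ∀ a {d s} → (∀ m → d ∣ s m) → ∀ n → d ∣ ⟦ a ⟧ s n
  ⟦⟧-preserves-∣ X       d∣s n = ∣m∣n⇒∣m+n (d∣s (suc n)) (∣n⇒∣m*n (+ n) (d∣s n))
  ⟦⟧-preserves-∣ (C z)   d∣s n = ∣n⇒∣m*n z (d∣s n)
  ⟦⟧-preserves-∣ (a ⊹ b) d∣s n = ∣m∣n⇒∣m+n (⟦⟧-preserves-∣ a d∣s n) (⟦⟧-preserves-∣ b d∣s n)
  ⟦⟧-preserves-∣ (a ⊙ b) d∣s n = ⟦⟧-preserves-∣ a (⟦⟧-preserves-∣ b d∣s) n

  infix 4 _≈_
  record _≈_ (a b : P) : Set where
    constructor mk≈
    field run : ∀ s n → ⟦ a ⟧ s n ≡ ⟦ b ⟧ s n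
  open _≈_ public

  0P 1P : P
  0P = C 0ℤ
  1P = C 1ℤ

  ⊖_ : P → P
  ⊖ a = C -1ℤ ⊙ a

  ⊹-isAbelianGroup : IsAbelianGroup _≈_ _⊹_ 0P ⊖_
  ⊹-isAbelianGroup = record
    { isGroup = record
      { isMonoid = record
        { isSemigroup = record
          { isMagma = record
            { isEquivalence = record
              { refl  = mk≈ λ s n → refl
              ; sym   = λ a≈b → mk≈ λ s n → sym (run a≈b s n)
              ; trans = λ a≈b b≈c → mk≈ λ s n → trans (run a≈b s n) (run b≈c s n)
              }
            ; ∙-cong = λ a≈b c≈d → mk≈ λ s n → cong₂ _+_ (run a≈b s n) (run c≈d s n)
            }
          ; assoc = λ a b c → mk≈ λ s n → ℤₚ.+-assoc (⟦ a ⟧ s n) _ _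
          }
        ; identity = (λ a → mk≈ λ s n → identityˡ (⟦ a ⟧ s n) (s n))
                   , (λ a → mk≈ λ s n → identityʳ (⟦ a ⟧ s n) (s n))
        }
      ; inverse = (λ a → mk≈ λ s n → inverseˡ (⟦ a ⟧ s n) (s n))
                , (λ a → mk≈ λ s n → inverseʳ (⟦ a ⟧ s n) (s n))
      ; ⁻¹-cong = λ a≈b → mk≈ λ s n → cong (-1ℤ *_) (run a≈b s n)
      }
    ; comm = λ a b → mk≈ λ s n → ℤₚ.+-comm (⟦ a ⟧ s n) _
    }
    where
    identityˡ : ∀ x y → 0ℤ * y + x ≡ x
    identityˡ = solve-∀
    identityʳ : ∀ x y → x + 0ℤ * y ≡ x
    identityʳ = solve-∀
    inverseˡ : ∀ x y → -1ℤ * x + x ≡ 0ℤ * y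
    inverseˡ = solve-∀
    inverseʳ : ∀ x y → x + -1ℤ * x ≡ 0ℤ * y
    inverseʳ = solve-∀

  ℙ-isCommutativeRing : IsCommutativeRing _≈_ _⊹_ _⊙_ ⊖_ 0P 1P
  ℙ-isCommutativeRing = record
    { isRing = record
      { +-isAbelianGroup = ⊹-isAbelianGroup
      ; *-cong = λ {a} {a′} {b} {b′} a≈a′ b≈b′ → mk≈ λ s n →
          ⟦⟧.cong-≗ a (run b≈b′ s) n ⟨ trans ⟩ run a≈a′ (⟦ b′ ⟧ s) n
      ; *-assoc = λ a b c → mk≈ λ s n → refl
      ; *-identity = (λ a → mk≈ λ s n → ℤₚ.*-identityˡ _)
                   , (λ a → mk≈ λ s n → ⟦⟧.cong-≗ a (λ m → ℤₚ.*-identityˡ (s m)) n)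
      ; distrib = (λ a b c → mk≈ λ s n → ⟦⟧.+-homo a (⟦ b ⟧ s) (⟦ c ⟧ s) n)
                , (λ a b c → mk≈ λ s n → refl)
      }
    ; *-comm = λ a b → mk≈ λ s n → ⟦⟧-comm a b s n
    }

  ℙ : CommutativeRing 0ℓ 0ℓ
  ℙ = record { isCommutativeRing = ℙ-isCommutativeRing }

  C-homomorphism : CommutativeRing.rawRing ℤ-commutativeRing -Raw-AlmostCommutative⟶ fromCommutativeRing ℙ
  C-homomorphism = record
    { ⟦_⟧    = C
    ; +-homo = λ a b → mk≈ λ s n → ℤₚ.*-distribʳ-+ (s n) a b
    ; *-homo = λ a b → mk≈ λ s n → ℤₚ.*-assoc a b (s n)
    ; -‿homo = λ a → mk≈ λ s n → lemma a (s n)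
    ; 0-homo = mk≈ λ s n → refl
    ; 1-homo = mk≈ λ s n → refl
    }
    where lemma : ∀ a x → (- a) * x ≡ -1ℤ * (a * x)
          lemma = solve-∀

  C-≟ : ∀ a b → Maybe (C a ≈ C b)
  C-≟ a b with a ≟ b
  ... | yes refl = just (mk≈ λ s n → refl)
  ... | no _     = nothing

  module ℙ-Solver = Algebra.Solver.Ring (CommutativeRing.rawRing ℤ-commutativeRing) (fromCommutativeRing ℙ) C-homomorphism C-≟
    using (solve; _:=_; _:+_; _:*_; :-_; con)

  module ℙ-Mult = Algebra.Definitions.RawMonoid (CommutativeRing.+-rawMonoid ℙ)

  open CommutativeRing ℙ using (*-cong; +-cong; *-assoc) renaming (refl to ≈-refl; trans to ≈-trans)

  ×1P≈C : ∀ m → m ℙ-Mult.× 1P ≈ C (+ m)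
  ×1P≈C zero    = mk≈ λ s n → refl
  ×1P≈C (suc m) = mk≈ λ s n → cong (_+_ (1ℤ * s n)) (run (×1P≈C m) s n) ⟨ trans ⟩ lemma (+ m) (s n)
    where lemma : ∀ k x → 1ℤ * x + k * x ≡ (1ℤ + k) * x
          lemma = solve-∀

  ∑ᴾ : ℕ → (ℕ → P) → P
  ∑ᴾ zero    t = 0P
  ∑ᴾ (suc n) t = ∑ᴾ n t ⊹ t n

  ⟦∑ᴾ⟧ : ∀ n t s m → ⟦ ∑ᴾ n t ⟧ s m ≡ ∑[ j < n ] ⟦ t j ⟧ s m
  ⟦∑ᴾ⟧ zero    t s m = ℤₚ.*-zeroˡ (s m)
  ⟦∑ᴾ⟧ (suc n) t s m = cong (_+ ⟦ t n ⟧ s m) (⟦∑ᴾ⟧ n t s m)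

  -- T s stands for r ↦ L(r(x + 1)), by (x + 1)ₙ = (x)ₙ + n (x)ₙ₋₁.
  T : Seq → Seq
  T s zero    = s zero
  T s (suc n) = s (suc n) + + suc n * s n

  T-linear : Linear T
  T-linear = record
    { cong-≗ = cong-≗
    ; linear = linear
    }
    where
    cong-≗ : ∀ {s t} → (∀ m → s m ≡ t m) → ∀ n → T s n ≡ T t n
    cong-≗ e zero    = e zero
    cong-≗ e (suc n) = cong₂ (λ a b → a + + suc n * b) (e (suc n)) (e n)
    linear : ∀ u v s t n → T (λ m → u * s m + v * t m) n ≡ u * T s n + v * T t n
    linear u v s t zero    = refl
    linear u v s t (suc n) = lemma u v (s (suc n)) (t (suc n)) (+ suc n) (s n) (t n)
      where lemma : ∀ u v a b k c d → u * a + v * b + k * (u * c + v * d) ≡ u * (a + k * c) + v * (b + k * d)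
            lemma = solve-∀

  T^ : ℕ → Seq → Seq
  T^ zero    s = s
  T^ (suc j) s = T (T^ j s)

  T^-linear : ∀ j → Linear (T^ j)
  T^-linear zero    = record { cong-≗ = λ e → e ; linear = λ u v s t n → refl }
  T^-linear (suc j) = ∘-linear T-linear (T^-linear j)

  module T^ (j : ℕ) = Linear (T^-linear j)

  T^-at-0 : ∀ j s → T^ j s 0 ≡ s 0
  T^-at-0 zero    s = refl
  T^-at-0 (suc j) s = T^-at-0 j s

  T^-preserves-∣ : ∀ j {d s} → (∀ m → d ∣ s m) → ∀ n → d ∣ T^ j s n
  T^-preserves-∣ zero    d∣s n       = d∣s n
  T^-preserves-∣ (suc j) d∣s zero    = T^-preserves-∣ j d∣s zero
  T^-preserves-∣ (suc j) d∣s (suc n) =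
    ∣m∣n⇒∣m+n (T^-preserves-∣ j d∣s (suc n)) (∣n⇒∣m*n (+ suc n) (T^-preserves-∣ j d∣s n))

  X-T : ∀ s n → ⟦ X ⟧ (T s) n ≡ T (λ m → ⟦ X ⟧ s m + s m) n
  X-T s zero    = lemma (s 1) (s 0)
    where lemma : ∀ a b → a + 1ℤ * b + 0ℤ * b ≡ a + 0ℤ * b + b
          lemma = solve-∀
  X-T s (suc n) = lemma (s (suc (suc n))) (s (suc n)) (s n) (+ n)
    where lemma : ∀ a b c k → a + (1ℤ + (1ℤ + k)) * b + (1ℤ + k) * (b + (1ℤ + k) * c)
                            ≡ a + (1ℤ + k) * b + b + (1ℤ + k) * (b + k * c + c)
          lemma = solve-∀

  X-T^ : ∀ j s n → ⟦ X ⟧ (T^ j s) n ≡ T^ j (⟦ X ⊹ C (+ j) ⟧ s) n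
  X-T^ zero    s n = sym (lemma (⟦ X ⟧ s n) (s n))
    where lemma : ∀ a b → a + 0ℤ * b ≡ a
          lemma = solve-∀
  X-T^ (suc j) s n = begin
    ⟦ X ⟧ (T (T^ j s)) n
      ≡⟨ X-T (T^ j s) n ⟩
    T (λ m → ⟦ X ⟧ (T^ j s) m + T^ j s m) n
      ≡⟨ T^.cong-≗ 1 (λ m → cong (_+ T^ j s m) (X-T^ j s m)) n ⟩
    T (λ m → T^ j (⟦ X ⊹ C (+ j) ⟧ s) m + T^ j s m) n
      ≡⟨ T^.cong-≗ 1 (λ m → sym (T^.+-homo j _ s m)) n ⟩
    T (T^ j (λ m → ⟦ X ⊹ C (+ j) ⟧ s m + s m)) n
      ≡⟨ T^.cong-≗ 1 (T^.cong-≗ j (λ m → lemma (⟦ X ⟧ s m) (+ j) (s m))) n ⟩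
    T (T^ j (⟦ X ⊹ C (+ suc j) ⟧ s)) n
      ∎
    where
    open ≡-Reasoning
    lemma : ∀ a k b → a + k * b + b ≡ a + (1ℤ + k) * b
    lemma = solve-∀

  T^-T : ∀ j s n → T^ j (T s) n ≡ T^ (suc j) s n
  T^-T zero    s n = refl
  T^-T (suc j) s n = T^.cong-≗ 1 (T^-T j s) n

  falling : P → ℕ → P
  falling Y zero    = 1P
  falling Y (suc j) = falling Y j ⊙ (Y ⊹ C (- + j))

  falling-at-0 : ∀ j s → ⟦ falling X j ⟧ s 0 ≡ s j
  falling-at-0 zero    s = ℤₚ.*-identityˡ (s 0)
  falling-at-0 (suc j) s = falling-at-0 j (⟦ X ⊹ C (- + j) ⟧ s) ⟨ trans ⟩ lemma (s (suc j)) (+ j) (s j)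
    where lemma : ∀ a k b → a + k * b + (- k) * b ≡ a
          lemma = solve-∀

  falling-1 : ∀ Y s m → ⟦ falling Y 1 ⟧ s m ≡ ⟦ Y ⟧ s m
  falling-1 Y s m = lemma (⟦ Y ⟧ s m) (s m)
    where lemma : ∀ a x → 1ℤ * (a + 0ℤ * x) ≡ a
          lemma = solve-∀

  falling-step : ∀ Y j s m → ⟦ falling Y j ⟧ (⟦ Y ⟧ s) m ≡ ⟦ falling Y (suc j) ⟧ s m + + j * ⟦ falling Y j ⟧ s m
  falling-step Y j s m = lemma x (⟦ falling Y j ⟧ s m) (+ j) ⟨ trans ⟩
    cong (_+ + j * ⟦ falling Y j ⟧ s m) (sym (⟦⟧.+-*-homo (falling Y j) (⟦ Y ⟧ s) (- + j) s m))
    where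
    x : ℤ
    x = ⟦ falling Y j ⟧ (⟦ Y ⟧ s) m
    lemma : ∀ x w k → x ≡ x + (- k) * w + k * w
    lemma = solve-∀

  falling-cong : ∀ {Y Y′} → Y ≈ Y′ → ∀ j → falling Y j ≈ falling Y′ j
  falling-cong Y≈Y′ zero    = ≈-refl
  falling-cong Y≈Y′ (suc j) = *-cong (falling-cong Y≈Y′ j) (+-cong Y≈Y′ ≈-refl)

  falling-peel : ∀ Y m → falling (Y ⊹ 1P) (suc m) ≈ (Y ⊹ 1P) ⊙ falling Y m
  falling-peel Y zero    = solve 1 (λ y → con 1ℤ :* ((y :+ con 1ℤ) :+ con 0ℤ) := (y :+ con 1ℤ) :* con 1ℤ) ≈-refl Y
    where open ℙ-Solver
  falling-peel Y (suc m) = ≈-trans (*-cong (falling-peel Y m) shifted) (*-assoc (Y ⊹ 1P) (falling Y m) (Y ⊹ C (- + m)))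
    where shifted : Y ⊹ 1P ⊹ C (- + suc m) ≈ Y ⊹ C (- + m)
          shifted = mk≈ λ s n → lemma (⟦ Y ⟧ s n) (+ m) (s n)
            where lemma : ∀ a k x → a + 1ℤ * x + - (1ℤ + k) * x ≡ a + - k * x
                  lemma = solve-∀

  falling-difference : ∀ Y m → falling (Y ⊹ 1P) (suc m) ≈ falling Y (suc m) ⊹ C (+ suc m) ⊙ falling Y m
  falling-difference Y m =
    ≈-trans (falling-peel Y m)
    (≈-trans (identity Y (falling Y m) (C (+ m)))
             (+-cong (*-cong ≈-refl (+-cong ≈-refl (mk≈ λ s n → negate (+ m) (s n))))
                     (*-cong (mk≈ λ s n → add (+ m) (s n)) ≈-refl)))
    where
    open ℙ-Solver
    negate : ∀ k x → -1ℤ * (k * x) ≡ - k * x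
    negate = solve-∀
    add : ∀ k x → 1ℤ * x + k * x ≡ (1ℤ + k) * x
    add = solve-∀
    identity : ∀ y F c → (y ⊹ 1P) ⊙ F ≈ F ⊙ (y ⊹ ⊖ c) ⊹ (1P ⊹ c) ⊙ F
    identity = solve 3 (λ y F c → (y :+ con 1ℤ) :* F := F :* (y :+ :- c) :+ (con 1ℤ :+ c) :* F) ≈-refl

  -- B = (A(x + j) − A(x))/j, in the form ⟦ A ⟧ ∘ T^ j = T^ j ∘ ⟦ A(x + j) ⟧.
  record DifferenceQuotient (j : ℕ) (A B : P) : Set where
    constructor mkDQ
    field law : ∀ s n → ⟦ A ⟧ (T^ j s) n ≡ T^ j (⟦ A ⊹ C (+ j) ⊙ B ⟧ s) n
  open DifferenceQuotient public

  module _ {j : ℕ} where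

    dq-resp : ∀ {A A′ B B′} → A ≈ A′ → B ≈ B′ → DifferenceQuotient j A B → DifferenceQuotient j A′ B′
    dq-resp A≈A′ B≈B′ dq = mkDQ λ s n →
      sym (run A≈A′ (T^ j s) n) ⟨ trans ⟩ law dq s n ⟨ trans ⟩
      T^.cong-≗ j (λ m → cong₂ (λ a b → a + + j * b) (run A≈A′ s m) (run B≈B′ s m)) n

    dq-X : DifferenceQuotient j X 1P
    dq-X = mkDQ λ s n →
      X-T^ j s n ⟨ trans ⟩ T^.cong-≗ j (λ m → cong (λ b → ⟦ X ⟧ s m + + j * b) (sym (ℤₚ.*-identityˡ (s m)))) n

    dq-C : ∀ z → DifferenceQuotient j (C z) 0P
    dq-C z = mkDQ λ s n → sym (T^.*-homo j z s n) ⟨ trans ⟩ T^.cong-≗ j (λ m → lemma z (+ j) (s m)) n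
      where lemma : ∀ z k x → z * x ≡ z * x + k * (0ℤ * x)
            lemma = solve-∀

    dq-⊹ : ∀ {A A′ B B′} → DifferenceQuotient j A B → DifferenceQuotient j A′ B′ →
           DifferenceQuotient j (A ⊹ A′) (B ⊹ B′)
    dq-⊹ {A} {A′} {B} {B′} dq dq′ = mkDQ λ s n →
      cong₂ _+_ (law dq s n) (law dq′ s n) ⟨ trans ⟩
      sym (T^.+-homo j (⟦ A ⊹ C (+ j) ⊙ B ⟧ s) (⟦ A′ ⊹ C (+ j) ⊙ B′ ⟧ s) n) ⟨ trans ⟩
      T^.cong-≗ j (λ m → lemma (⟦ A ⟧ s m) (⟦ A′ ⟧ s m) (⟦ B ⟧ s m) (⟦ B′ ⟧ s m) (+ j)) n
      where lemma : ∀ a a′ b b′ k → a + k * b + (a′ + k * b′) ≡ a + a′ + k * (b + b′)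
            lemma = solve-∀

    dq-⊙ : ∀ {A A′ B B′} → DifferenceQuotient j A B → DifferenceQuotient j A′ B′ →
           DifferenceQuotient j (A ⊙ A′) (B ⊙ (A′ ⊹ C (+ j) ⊙ B′) ⊹ A ⊙ B′)
    dq-⊙ {A} {A′} {B} {B′} dq dq′ = mkDQ λ s n →
      ⟦⟧.cong-≗ A (law dq′ s) n ⟨ trans ⟩ law dq (⟦ A′ ⊹ C (+ j) ⊙ B′ ⟧ s) n ⟨ trans ⟩
      T^.cong-≗ j (run (leibniz A B A′ B′ (C (+ j))) s) n
      where
      open ℙ-Solver
      leibniz : ∀ a b a′ b′ c →
                (a ⊹ c ⊙ b) ⊙ (a′ ⊹ c ⊙ b′) ≈ a ⊙ a′ ⊹ c ⊙ (b ⊙ (a′ ⊹ c ⊙ b′) ⊹ a ⊙ b′)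
      leibniz = solve 5 (λ a b a′ b′ c → (a :+ c :* b) :* (a′ :+ c :* b′)
                                         := a :* a′ :+ c :* (b :* (a′ :+ c :* b′) :+ a :* b′))
                        (mk≈ λ s n → refl)

  diffQuot : ∀ j A → Σ P (DifferenceQuotient j A)
  diffQuot j X       = 1P , dq-X
  diffQuot j (C z)   = 0P , dq-C z
  diffQuot j (a ⊹ b) with diffQuot j a | diffQuot j b
  ... | B , dq | B′ , dq′ = B ⊹ B′ , dq-⊹ dq dq′
  diffQuot j (a ⊙ b) with diffQuot j a | diffQuot j b
  ... | B , dq | B′ , dq′ = B ⊙ (b ⊹ C (+ j) ⊙ B′) ⊹ a ⊙ B′ , dq-⊙ dq dq′

  T^-congruence : ∀ j {d u} → (∀ m → d ∣ u m) → ∀ n → + j * d ∣ T^ j u n - u n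
  T^-congruence j {d} {u} d∣u n with diffQuot j (falling X n)
  ... | B , dq = subst (+ j * d ∣_) (sym expansion) (*-monoˡ-∣ (+ j) (⟦⟧-preserves-∣ B d∣u 0))
    where
    open ≡-Reasoning
    expansion : T^ j u n - u n ≡ + j * ⟦ B ⟧ u 0
    expansion = begin
      T^ j u n - u n                              ≡⟨ cong (_- u n) (sym (falling-at-0 n (T^ j u))) ⟩
      ⟦ falling X n ⟧ (T^ j u) 0 - u n            ≡⟨ cong (_- u n) (law dq u 0 ⟨ trans ⟩ T^-at-0 j _) ⟩
      ⟦ falling X n ⟧ u 0 + + j * ⟦ B ⟧ u 0 - u n ≡⟨ cong (λ v → v + + j * ⟦ B ⟧ u 0 - u n) (falling-at-0 n u) ⟩
      u n + + j * ⟦ B ⟧ u 0 - u n                 ≡⟨ lemma (u n) (+ j * ⟦ B ⟧ u 0) ⟩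
      + j * ⟦ B ⟧ u 0                             ∎
      where lemma : ∀ a b → a + b - a ≡ b
            lemma = solve-∀



module StirlingExpansion where

  open import Data.Nat.Base as ℕ using (zero; suc; _<_; s≤s)
  import Data.Nat.Properties as ℕₚ
  import Data.Integer.Base as ℤ
  open import Data.Integer.Base using (ℤ; +_; 0ℤ; 1ℤ; _+_; _*_; _-_)
  import Data.Integer.Properties as ℤₚ
  open import Data.Integer.Tactic.RingSolver using (solve-∀)
  open import Data.Sum.Base using (inj₁; inj₂)
  open import Function.Base using (_∘_; _⟨_⟩_)
  open import Relation.Binary.PropositionalEquality
  open import Defs using (S)
  open IntegerSums
  open PolynomialOperators
  open import Algebra.Properties.CommutativeSemiring.Exp (CommutativeRing.commutativeSemiring ℙ) using (_^_)

  S-beyond : ∀ {n k} → n < k → S n k ≡ 0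
  S-beyond {zero}  {suc k} _         = refl
  S-beyond {suc n} {suc k} (s≤s n<k) =
    cong₂ (λ a b → suc k ℕ.* a ℕ.+ b) (S-beyond (ℕₚ.m<n⇒m<1+n n<k)) (S-beyond n<k) ⟨ trans ⟩
    cong (ℕ._+ 0) (ℕₚ.*-zeroʳ (suc k))

  S-zero : ∀ {n} → 0 < n → S n 0 ≡ 0
  S-zero {suc n} _ = refl

  S-one : ∀ {n} → 0 < n → S n 1 ≡ 1
  S-one {suc zero}    _ = refl
  S-one {suc (suc n)} _ = ℕₚ.+-identityʳ _ ⟨ trans ⟩ ℕₚ.*-identityˡ _ ⟨ trans ⟩ S-one {suc n} (s≤s ℕ.z≤n)

  S-diagonal : ∀ n → S n n ≡ 1
  S-diagonal zero    = refl
  S-diagonal (suc n) =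
    cong₂ (λ a b → suc n ℕ.* a ℕ.+ b) (S-beyond (ℕₚ.n<1+n n)) (S-diagonal n) ⟨ trans ⟩
    cong (ℕ._+ 1) (ℕₚ.*-zeroʳ (suc n))

  stirling : ∀ Y n s m → ⟦ Y ^ n ⟧ s m ≡ ∑[ j < suc n ] (+ S n j * ⟦ falling Y j ⟧ s m)
  stirling Y zero    s m = lemma (s m)
    where lemma : ∀ x → 1ℤ * x ≡ 0ℤ + 1ℤ * (1ℤ * x)
          lemma = solve-∀
  stirling Y (suc n) s m = begin
    ⟦ Y ⊙ Y ^ n ⟧ s m
      ≡⟨ ⟦⟧-comm Y (Y ^ n) s m ⟩
    ⟦ Y ^ n ⟧ (⟦ Y ⟧ s) m
      ≡⟨ stirling Y n (⟦ Y ⟧ s) m ⟩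
    ∑[ j < suc n ] (+ S n j * ⟦ falling Y j ⟧ (⟦ Y ⟧ s) m)
      ≡⟨ ∑-cong (λ j → cong (+ S n j *_) (falling-step Y j s m)) (suc n) ⟩
    ∑[ j < suc n ] (+ S n j * (y (suc j) + + j * y j))
      ≡⟨ ∑-pascal (+_ ∘ S n) (+_ ∘ S (suc n)) +_ y c′0 c′-suc n top ⟨
    ∑[ j < suc (suc n) ] (+ S (suc n) j * y j)
      ∎
    where
    open ≡-Reasoning
    y : ℕ → ℤ
    y j = ⟦ falling Y j ⟧ s m
    c′0 : + S (suc n) 0 ≡ + 0 * + S n 0
    c′0 = sym (ℤₚ.*-zeroˡ (+ S n 0))
    c′-suc : ∀ j → + S (suc n) (suc j) ≡ + suc j * + S n (suc j) + + S n j
    c′-suc j = ℤₚ.pos-+ (suc j ℕ.* S n (suc j)) (S n j) ⟨ trans ⟩ cong (_+ + S n j) (ℤₚ.pos-* (suc j) (S n (suc j)))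
    top : + S n (suc n) ≡ 0ℤ
    top = cong +_ (S-beyond (ℕₚ.n<1+n n))

  -- falling-ℤ k, as a sequence, is evaluation at k: L((x)ₙ) = (k)ₙ.
  falling-ℤ : ℤ → ℕ → ℤ
  falling-ℤ k zero    = 1ℤ
  falling-ℤ k (suc j) = falling-ℤ k j * (k - + j)

  X^n-falling-ℤ : ∀ k n m → ⟦ X ^ n ⟧ (falling-ℤ k) m ≡ k ℤ.^ n * falling-ℤ k m
  X^n-falling-ℤ k zero    m = refl
  X^n-falling-ℤ k (suc n) m = begin
    ⟦ X ⟧ (⟦ X ^ n ⟧ (falling-ℤ k)) m           ≡⟨ ⟦⟧.cong-≗ X (X^n-falling-ℤ k n) m ⟩
    ⟦ X ⟧ (λ i → k ℤ.^ n * falling-ℤ k i) m     ≡⟨ ⟦⟧.*-homo X (k ℤ.^ n) (falling-ℤ k) m ⟩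
    k ℤ.^ n * ⟦ X ⟧ (falling-ℤ k) m             ≡⟨ lemma (k ℤ.^ n) k (falling-ℤ k m) (+ m) ⟩
    k * k ℤ.^ n * falling-ℤ k m                 ∎
    where
    open ≡-Reasoning
    lemma : ∀ c k f m → c * (f * (k - m) + m * f) ≡ k * c * f
    lemma = solve-∀

  stirling-ℤ : ∀ k n → k ℤ.^ n ≡ ∑[ j < suc n ] (+ S n j * falling-ℤ k j)
  stirling-ℤ k n =
    sym (ℤₚ.*-identityʳ (k ℤ.^ n)) ⟨ trans ⟩ sym (X^n-falling-ℤ k n 0) ⟨ trans ⟩
    stirling X n (falling-ℤ k) 0 ⟨ trans ⟩
    ∑-cong (λ j → cong (+ S n j *_) (falling-at-0 j (falling-ℤ k))) (suc n)

  falling-ℤ-beyond : ∀ {k j} → k < j → falling-ℤ (+ k) j ≡ 0ℤ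
  falling-ℤ-beyond {k} {suc j} (s≤s k≤j) with ℕₚ.m≤n⇒m<n∨m≡n k≤j
  ... | inj₁ k<j  = cong (_* (+ k - + j)) (falling-ℤ-beyond k<j)
  ... | inj₂ refl = cong (falling-ℤ (+ k) k *_) (ℤₚ.+-inverseʳ (+ k)) ⟨ trans ⟩ ℤₚ.*-zeroʳ (falling-ℤ (+ k) k)

  falling-ℤ-suc : ∀ k j → falling-ℤ (+ suc k) (suc j) ≡ + suc k * falling-ℤ (+ k) j
  falling-ℤ-suc k zero    = lemma (+ suc k)
    where lemma : ∀ a → 1ℤ * (a - 0ℤ) ≡ a * 1ℤ
          lemma = solve-∀
  falling-ℤ-suc k (suc j) = cong (_* (+ suc k - + suc j)) (falling-ℤ-suc k j) ⟨ trans ⟩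
                            lemma (+ k) (+ j) (falling-ℤ (+ k) j)
    where lemma : ∀ k j f → (1ℤ + k) * f * ((1ℤ + k) - (1ℤ + j)) ≡ (1ℤ + k) * (f * (k - j))
          lemma = solve-∀

  falling-ℤ-diagonal : ∀ k → falling-ℤ (+ k) k ≡ + (k ℕ.!)
  falling-ℤ-diagonal zero    = refl
  falling-ℤ-diagonal (suc k) =
    falling-ℤ-suc k k ⟨ trans ⟩ cong (+ suc k *_) (falling-ℤ-diagonal k) ⟨ trans ⟩ sym (ℤₚ.pos-* (suc k) (k ℕ.!))


module IdealPowers {c ℓ} (R : CommutativeRing c ℓ) (π γ : CommutativeRing.Carrier R) where

  open import Data.Nat.Base as ℕ using (zero; suc; _≤_; z≤n; s≤s)
  open import Level using (_⊔_)
  open import Relation.Binary.Bundles using (Setoid)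
  open CommutativeRing R
  open import Algebra.Properties.CommutativeSemiring.Exp commutativeSemiring using (_^_; ^-congˡ)
  open import Algebra.Definitions.RawMonoid +-rawMonoid using (_×_)
  open import Algebra.Properties.Ring ring using (-1*x≈-x)
  open import Algebra.Solver.Ring.NaturalCoefficients.Default commutativeSemiring using (solve; _:=_; _:+_; _:*_; con)
  open import Relation.Binary.Reasoning.Setoid setoid

  infix 4 _∈J^_
  data _∈J^_ : Carrier → ℕ → Set (c ⊔ ℓ) where
    J⁰    : ∀ x → x ∈J^ 0
    J-gen : ∀ {k x y z} → x ∈J^ k → y ∈J^ k → z ≈ π * x + γ * y → z ∈J^ suc k

  ∈J-resp : ∀ {k x y} → x ≈ y → x ∈J^ k → y ∈J^ k
  ∈J-resp x≈y (J⁰ _)        = J⁰ _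
  ∈J-resp x≈y (J-gen a b e) = J-gen a b (trans (sym x≈y) e)

  0∈J : ∀ k → 0# ∈J^ k
  0∈J zero    = J⁰ 0#
  0∈J (suc k) = J-gen (0∈J k) (0∈J k) (sym (trans (+-cong (zeroʳ π) (zeroʳ γ)) (+-identityˡ 0#)))

  ∈J-+ : ∀ {k x y} → x ∈J^ k → y ∈J^ k → x + y ∈J^ k
  ∈J-+ (J⁰ _)        (J⁰ _)           = J⁰ _
  ∈J-+ (J-gen a b e) (J-gen a′ b′ e′) = J-gen (∈J-+ a a′) (∈J-+ b b′) (trans (+-cong e e′) (regroup _ _ _ _ π γ))
    where regroup : ∀ a b a′ b′ π γ → (π * a + γ * b) + (π * a′ + γ * b′) ≈ π * (a + a′) + γ * (b + b′)
          regroup = solve 6 (λ a b a′ b′ π γ → ((π :* a :+ γ :* b) :+ (π :* a′ :+ γ :* b′))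
                                             := (π :* (a :+ a′) :+ γ :* (b :+ b′))) refl

  ∈J-*ˡ : ∀ {k x} r → x ∈J^ k → r * x ∈J^ k
  ∈J-*ˡ r (J⁰ _)        = J⁰ _
  ∈J-*ˡ r (J-gen a b e) = J-gen (∈J-*ˡ r a) (∈J-*ˡ r b) (trans (*-congˡ e) (distribute r _ _ π γ))
    where distribute : ∀ r a b π γ → r * (π * a + γ * b) ≈ π * (r * a) + γ * (r * b)
          distribute = solve 5 (λ r a b π γ → (r :* (π :* a :+ γ :* b)) := (π :* (r :* a) :+ γ :* (r :* b))) refl

  ∈J-*ʳ : ∀ {k x} r → x ∈J^ k → x * r ∈J^ k
  ∈J-*ʳ {x = x} r x∈J = ∈J-resp (*-comm r x) (∈J-*ˡ r x∈J)

  π*∈J : ∀ {k x} → x ∈J^ k → π * x ∈J^ suc k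
  π*∈J {k} x∈J = J-gen x∈J (0∈J k) (sym (trans (+-congˡ (zeroʳ γ)) (+-identityʳ _)))

  γ*∈J : ∀ {k x} → x ∈J^ k → γ * x ∈J^ suc k
  γ*∈J {k} x∈J = J-gen (0∈J k) x∈J (sym (trans (+-congʳ (zeroʳ π)) (+-identityˡ _)))

  ∈J-≤ : ∀ {k m x} → k ≤ m → x ∈J^ m → x ∈J^ k
  ∈J-≤ z≤n       _             = J⁰ _
  ∈J-≤ (s≤s k≤m) (J-gen a b e) = J-gen (∈J-≤ k≤m a) (∈J-≤ k≤m b) e

  ∈J-* : ∀ {a b x y} → x ∈J^ a → y ∈J^ b → x * y ∈J^ (a ℕ.+ b)
  ∈J-* (J⁰ x)        y∈J = ∈J-*ˡ x y∈J
  ∈J-* (J-gen p q e) y∈J = J-gen (∈J-* p y∈J) (∈J-* q y∈J) (trans (*-congʳ e) (distribute _ _ _ π γ))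
    where distribute : ∀ y p q π γ → (π * p + γ * q) * y ≈ π * (p * y) + γ * (q * y)
          distribute = solve 5 (λ y p q π γ → ((π :* p :+ γ :* q) :* y) := (π :* (p :* y) :+ γ :* (q :* y))) refl

  -- Stated without subtraction so that the semiring solver can discharge the ring identities.
  infix 4 _≡_modJ^_
  record _≡_modJ^_ (x y : Carrier) (k : ℕ) : Set (c ⊔ ℓ) where
    constructor mk≡
    field
      {diff} : Carrier
      diff∈J : diff ∈J^ k
      x≈y+d  : x ≈ y + diff

  ≈⇒≡ : ∀ {k x y} → x ≈ y → x ≡ y modJ^ k
  ≈⇒≡ {k} x≈y = mk≡ (0∈J k) (trans x≈y (sym (+-identityʳ _)))

  ≡-refl : ∀ {k x} → x ≡ x modJ^ k
  ≡-refl = ≈⇒≡ refl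

  -∈J : ∀ {k x} → x ∈J^ k → - x ∈J^ k
  -∈J {x = x} x∈J = ∈J-resp (-1*x≈-x x) (∈J-*ˡ (- 1#) x∈J)

  ≡-sym : ∀ {k x y} → x ≡ y modJ^ k → y ≡ x modJ^ k
  ≡-sym {x = x} {y} (mk≡ {d} d∈J x≈y+d) = mk≡ (-∈J d∈J) (begin
    y              ≈⟨ +-identityʳ y ⟨
    y + 0#         ≈⟨ +-congˡ (-‿inverseʳ d) ⟨
    y + (d + - d)  ≈⟨ +-assoc y d (- d) ⟨
    y + d + - d    ≈⟨ +-congʳ x≈y+d ⟨
    x + - d        ∎)

  ≡-trans : ∀ {k x y z} → x ≡ y modJ^ k → y ≡ z modJ^ k → x ≡ z modJ^ k
  ≡-trans {z = z} (mk≡ {d} d∈J x≈y+d) (mk≡ {e} e∈J y≈z+e) =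
    mk≡ (∈J-+ e∈J d∈J) (trans x≈y+d (trans (+-congʳ y≈z+e) (+-assoc z e d)))

  ≡-+ : ∀ {k x x′ y y′} → x ≡ x′ modJ^ k → y ≡ y′ modJ^ k → x + y ≡ x′ + y′ modJ^ k
  ≡-+ (mk≡ d∈J x≈) (mk≡ e∈J y≈) = mk≡ (∈J-+ d∈J e∈J) (trans (+-cong x≈ y≈) (regroup _ _ _ _))
    where regroup : ∀ x y d e → (x + d) + (y + e) ≈ (x + y) + (d + e)
          regroup = solve 4 (λ x y d e → ((x :+ d) :+ (y :+ e)) := ((x :+ y) :+ (d :+ e))) refl

  ≡-* : ∀ {k x x′ y y′} → x ≡ x′ modJ^ k → y ≡ y′ modJ^ k → x * y ≡ x′ * y′ modJ^ k
  ≡-* {x′ = x′} {y′ = y′} (mk≡ {d} d∈J x≈) (mk≡ {e} e∈J y≈) =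
    mk≡ (∈J-+ (∈J-*ʳ (y′ + e) d∈J) (∈J-*ˡ x′ e∈J)) (trans (*-cong x≈ y≈) (expand x′ y′ d e))
    where expand : ∀ x y d e → (x + d) * (y + e) ≈ x * y + (d * (y + e) + x * e)
          expand = solve 4 (λ x y d e → ((x :+ d) :* (y :+ e)) := (x :* y :+ (d :* (y :+ e) :+ x :* e))) refl

  ≡-^ : ∀ {k x y} → x ≡ y modJ^ k → ∀ n → x ^ n ≡ y ^ n modJ^ k
  ≡-^ x≡y zero    = ≡-refl
  ≡-^ x≡y (suc n) = ≡-* x≡y (≡-^ x≡y n)

  geometric-sum : Carrier → ℕ → Carrier
  geometric-sum u zero    = 0#
  geometric-sum u (suc m) = 1# + u * geometric-sum u m

  geometric : ∀ d m → (1# + d) ^ m ≈ 1# + d * geometric-sum (1# + d) m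
  geometric d zero    = sym (trans (+-congˡ (zeroʳ d)) (+-identityʳ 1#))
  geometric d (suc m) = trans (*-congˡ (geometric d m)) (step d (geometric-sum (1# + d) m))
    where step : ∀ d g → (1# + d) * (1# + d * g) ≈ 1# + d * (1# + (1# + d) * g)
          step = solve 2 (λ d g → ((con 1 :+ d) :* (con 1 :+ d :* g)) := (con 1 :+ d :* (con 1 :+ (con 1 :+ d) :* g))) refl

  geometric-sum-≡ : ∀ {d} m → d ∈J^ 1 → geometric-sum (1# + d) m ≡ m × 1# modJ^ 1
  geometric-sum-≡ zero    d∈J = ≡-refl
  geometric-sum-≡ (suc m) d∈J =
    ≡-+ ≡-refl (≡-trans (≡-* (mk≡ d∈J refl) (geometric-sum-≡ m d∈J)) (≈⇒≡ (*-identityˡ _)))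

  ^-lift : ∀ {k x} m → m × 1# ∈J^ 1 → x ≡ 1# modJ^ suc k → x ^ m ≡ 1# modJ^ suc (suc k)
  ^-lift m m∈J (mk≡ {d} d∈J x≈1+d) =
    mk≡ (∈J-* g∈J d∈J) (trans (^-congˡ m x≈1+d) (trans (geometric d m) (+-congˡ (*-comm d g))))
    where
    g : Carrier
    g = geometric-sum (1# + d) m
    g∈J : g ∈J^ 1
    g∈J with geometric-sum-≡ m (∈J-≤ (s≤s z≤n) d∈J)
    ... | mk≡ e∈J g≈ = ∈J-resp (sym g≈) (∈J-+ m∈J e∈J)

  ≡-setoid : ℕ → Setoid c (c ⊔ ℓ)
  ≡-setoid k = record
    { Carrier       = Carrier
    ; _≈_           = _≡_modJ^ k
    ; isEquivalence = record { refl = ≡-refl ; sym = ≡-sym ; trans = ≡-trans }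
    }


module ComplementaryBellFunctional where

  open import Data.Nat.Base using (zero; suc)
  open import Data.Integer.Base using (+_; 0ℤ; 1ℤ; -1ℤ; _+_; _*_; -_)
  import Data.Integer.Properties as ℤₚ
  open import Data.Integer.Tactic.RingSolver using (solve-∀)
  open import Function.Base using (_⟨_⟩_)
  open import Relation.Binary.PropositionalEquality
  open import Defs using (S; partialSum; f)
  open IntegerSums
  open PolynomialOperators
  open StirlingExpansion
  open import Algebra.Properties.CommutativeSemiring.Exp (CommutativeRing.commutativeSemiring ℙ) using (_^_)

  ψ : Seq
  ψ = sgn

  X-ψ : ∀ n → ⟦ X ⟧ ψ n ≡ - T ψ n
  X-ψ zero    = refl
  X-ψ (suc n) = lemma (sgn n) (+ suc n)
    where lemma : ∀ x k → - (- x) + k * (- x) ≡ - (- x + k * x)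
          lemma = solve-∀

  falling-ψ : ∀ j n → ⟦ falling X j ⟧ ψ n ≡ sgn j * T^ j ψ n
  falling-ψ zero    n = refl
  falling-ψ (suc j) n = begin
    ⟦ falling X j ⊙ (X ⊹ C (- + j)) ⟧ ψ n
      ≡⟨ ⟦⟧-comm (falling X j) (X ⊹ C (- + j)) ψ n ⟩
    ⟦ X ⊹ C (- + j) ⟧ (⟦ falling X j ⟧ ψ) n
      ≡⟨ ⟦⟧.cong-≗ (X ⊹ C (- + j)) (falling-ψ j) n ⟨ trans ⟩ ⟦⟧.*-homo (X ⊹ C (- + j)) (sgn j) (T^ j ψ) n ⟩
    sgn j * (⟦ X ⟧ (T^ j ψ) n + - + j * T^ j ψ n)
      ≡⟨ cong (λ v → sgn j * (v + - + j * T^ j ψ n)) (X-T^ j ψ n) ⟩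
    sgn j * (T^ j (⟦ X ⊹ C (+ j) ⟧ ψ) n + - + j * T^ j ψ n)
      ≡⟨ cong (sgn j *_) (T^.+-*-homo j _ (- + j) ψ n) ⟨
    sgn j * T^ j (λ m → ⟦ X ⊹ C (+ j) ⟧ ψ m + - + j * ψ m) n
      ≡⟨ cong (sgn j *_) (T^.cong-≗ j (λ m → cancel (⟦ X ⟧ ψ m) (+ j) (ψ m) ⟨ trans ⟩ X-ψ m) n) ⟩
    sgn j * T^ j (λ m → - T ψ m) n
      ≡⟨ cong (sgn j *_) (T^.cong-≗ j (λ m → sym (ℤₚ.-1*i≡-i (T ψ m))) n ⟨ trans ⟩ T^.*-homo j -1ℤ (T ψ) n) ⟩
    sgn j * (-1ℤ * T^ j (T ψ) n)
      ≡⟨ cong (λ v → sgn j * (-1ℤ * v)) (T^-T j ψ n) ⟩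
    sgn j * (-1ℤ * T^ (suc j) ψ n)
      ≡⟨ lemma (sgn j) (T^ (suc j) ψ n) ⟩
    - sgn j * T^ (suc j) ψ n
      ∎
    where
    open ≡-Reasoning
    cancel : ∀ a k b → a + k * b + - k * b ≡ a
    cancel = solve-∀
    lemma : ∀ a b → a * (-1ℤ * b) ≡ - a * b
    lemma = solve-∀

  partialSum-∑ : ∀ n m → partialSum n m ≡ ∑[ j < suc m ] (+ S n j * sgn j)
  partialSum-∑ n zero    = lemma (+ S n 0)
    where lemma : ∀ x → 1ℤ * x ≡ 0ℤ + x * 1ℤ
          lemma = solve-∀
  partialSum-∑ n (suc m) =
    cong₂ _+_ (partialSum-∑ n m) (ℤₚ.*-comm (sgn (suc m)) (+ S n (suc m)))

  f≡⟦X^n⟧ψ : ∀ n → f n ≡ ⟦ X ^ n ⟧ ψ 0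
  f≡⟦X^n⟧ψ n =
    partialSum-∑ n n ⟨ trans ⟩
    ∑-cong (λ j → cong (+ S n j *_) (sym (falling-at-0 j ψ))) (suc n) ⟨ trans ⟩
    sym (stirling X n ψ 0)


module PrimeCongruences (p : ℕ) (p-prime : Prime p) where

  open import Data.Nat.Base as ℕ using (zero; suc; _<_; _≤_; _>_; z≤n; s≤s; _!; _∸_; nonTrivial⇒n>1)
  import Data.Nat.Properties as ℕₚ
  import Data.Nat.Divisibility as ℕᵈ
  open import Data.Nat.Combinatorics using (nCk+nC[k+1]≡[n+1]C[k+1]; k>n⇒nCk≡0; nCn≡1; nCk≡n!/k![n-k]!; k![n∸k]!∣n!)
    renaming (_C_ to _choose_)
  open import Data.Nat.DivMod using (m/n*n≡m)
  open import Data.Nat.Induction using (<-rec)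
  open import Data.Nat.Primality using (euclidsLemma; prime⇒nonTrivial)
  import Data.Integer.Base as ℤ
  open import Data.Integer.Base using (ℤ; +_; 0ℤ; 1ℤ; _+_; _*_; _-_)
  import Data.Integer.Properties as ℤₚ
  open import Data.Integer.Divisibility.Signed using (_∣_; ∣ᵤ⇒∣; ∣⇒∣ᵤ; ∣m∣n⇒∣m+n; ∣m∣n⇒∣m-n; ∣m⇒∣m*n)
  open import Data.Integer.Tactic.RingSolver using (solve-∀)
  open import Data.Sum.Base using (inj₁; inj₂)
  open import Function.Base using (_∘_; _⟨_⟩_)
  open import Relation.Binary.Definitions using (tri<; tri≈; tri>)
  open import Relation.Binary.PropositionalEquality
  open import Relation.Nullary.Negation.Core using (¬_; contradiction)
  open import Defs using (S)
  open IntegerSums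
  open PolynomialOperators
  open StirlingExpansion

  p>1 : p > 1
  p>1 = nonTrivial⇒n>1 p {{prime⇒nonTrivial p-prime}}

  0<p : 0 < p
  0<p = ℕₚ.<-trans ℕₚ.0<1+n p>1

  p∤m*n : ∀ {m n} → ¬ p ℕᵈ.∣ m → ¬ p ℕᵈ.∣ n → ¬ p ℕᵈ.∣ m ℕ.* n
  p∤m*n {m} {n} p∤m p∤n p∣mn with euclidsLemma m n p-prime p∣mn
  ... | inj₁ p∣m = p∤m p∣m
  ... | inj₂ p∣n = p∤n p∣n

  ∣m*n∧∤n⇒∣m : ∀ {m n} → p ℕᵈ.∣ m ℕ.* n → ¬ p ℕᵈ.∣ n → p ℕᵈ.∣ m
  ∣m*n∧∤n⇒∣m {m} {n} p∣mn p∤n with euclidsLemma m n p-prime p∣mn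
  ... | inj₁ p∣m = p∣m
  ... | inj₂ p∣n = contradiction p∣n p∤n

  p∤m! : ∀ {m} → m < p → ¬ p ℕᵈ.∣ m !
  p∤m! {zero}  _   p∣1 = ℕₚ.<⇒≢ p>1 (sym (ℕᵈ.∣1⇒≡1 p∣1))
  p∤m! {suc m} m<p     = p∤m*n (λ p∣1+m → ℕₚ.<⇒≱ m<p (ℕᵈ.∣⇒≤ p∣1+m)) (p∤m! (ℕₚ.<-trans (ℕₚ.n<1+n m) m<p))

  n∣n! : ∀ {n} → 0 < n → n ℕᵈ.∣ n !
  n∣n! {suc n} _ = ℕᵈ.divides (n !) (ℕₚ.*-comm (suc n) (n !))

  p∣p-choose-k : ∀ {k} → 0 < k → k < p → p ℕᵈ.∣ p choose k
  p∣p-choose-k {k} 0<k k<p = ∣m*n∧∤n⇒∣m p∣p! (p∤m*n (p∤m! k<p) (p∤m! (ℕₚ.∸-monoʳ-< 0<k k≤p)))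
    where
    k≤p : k ≤ p
    k≤p = ℕₚ.<⇒≤ k<p
    p∣p! : p ℕᵈ.∣ (p choose k) ℕ.* (k ! ℕ.* (p ∸ k) !)
    p∣p! = subst (p ℕᵈ.∣_) (sym (cong (ℕ._* (k ! ℕ.* (p ∸ k) !)) (nCk≡n!/k![n-k]! k≤p) ⟨ trans ⟩
                                 m/n*n≡m {{k ℕₚ.!* (p ∸ k) !≢0}} (k![n∸k]!∣n! k≤p)))
                 (n∣n! (ℕₚ.<-trans 0<k k<p))

  binomial : ∀ (x : ℤ) n → (1ℤ + x) ℤ.^ n ≡ ∑[ i < suc n ] (+ (n choose i) * x ℤ.^ i)
  binomial x zero    = refl
  binomial x (suc n) = begin
    (1ℤ + x) * (1ℤ + x) ℤ.^ n                                   ≡⟨ cong ((1ℤ + x) *_) (binomial x n) ⟩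
    (1ℤ + x) * ∑[ i < suc n ] (+ (n choose i) * x ℤ.^ i)        ≡⟨ ∑-distribˡ-* (1ℤ + x) _ (suc n) ⟨
    ∑[ i < suc n ] ((1ℤ + x) * (+ (n choose i) * x ℤ.^ i))      ≡⟨ ∑-cong (λ i → lemma x (+ (n choose i)) (x ℤ.^ i)) (suc n) ⟩
    ∑[ i < suc n ] (+ (n choose i) * (x ℤ.^ suc i + 1ℤ * x ℤ.^ i))
      ≡⟨ ∑-pascal (+_ ∘ (n choose_)) (+_ ∘ (suc n choose_)) (λ _ → 1ℤ) (x ℤ.^_) refl pascal n top ⟨
    ∑[ i < suc (suc n) ] (+ (suc n choose i) * x ℤ.^ i)         ∎
    where
    open ≡-Reasoning
    lemma : ∀ x c y → (1ℤ + x) * (c * y) ≡ c * (x * y + 1ℤ * y)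
    lemma = solve-∀
    pascal : ∀ i → + (suc n choose suc i) ≡ 1ℤ * + (n choose suc i) + + (n choose i)
    pascal i = cong +_ (sym (nCk+nC[k+1]≡[n+1]C[k+1] n i) ⟨ trans ⟩ ℕₚ.+-comm (n choose i) (n choose suc i)) ⟨ trans ⟩
               ℤₚ.pos-+ (n choose suc i) (n choose i) ⟨ trans ⟩
               cong (_+ + (n choose i)) (sym (ℤₚ.*-identityˡ (+ (n choose suc i))))
    top : + (n choose suc n) ≡ 0ℤ
    top = cong +_ (k>n⇒nCk≡0 (ℕₚ.n<1+n n))

  fermat : ∀ a → + p ∣ (+ suc a) ℤ.^ p - + suc a
  fermat zero    = subst (+ p ∣_) (sym (cong (_- 1ℤ) (ℤₚ.^-zeroˡ p))) ∣0ℤ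
  fermat (suc a) = subst (+ p ∣_) (sym expansion) (∣m∣n⇒∣m+n binomial-mod-p (fermat a))
    where
    x : ℤ
    x = + suc a
    t : ℕ → ℤ
    t i = + (p choose i) * x ℤ.^ i
    p∣t : ∀ i → i ≢ 0 → i ≢ p → + p ∣ t i
    p∣t i i≢0 i≢p with ℕₚ.<-cmp i p
    ... | tri< i<p _ _ = ∣m⇒∣m*n {m = + (p choose i)} (x ℤ.^ i) (∣ᵤ⇒∣ (p∣p-choose-k (ℕₚ.n≢0⇒n>0 i≢0) i<p))
    ... | tri≈ _ i≡p _ = contradiction i≡p i≢p
    ... | tri> _ _ i>p = subst (+ p ∣_) (sym (cong (λ c → + c * x ℤ.^ i) (k>n⇒nCk≡0 i>p))) ∣0ℤ
    binomial-mod-p : + p ∣ ∑[ i < suc p ] t i - (1ℤ + x ℤ.^ p)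
    binomial-mod-p = ∑-mod-two-terms t (x ℤ.^_) (x ℤ.^_) (suc p) (s≤s z≤n) (ℕₚ.n<1+n p) (ℕₚ.<⇒≢ 0<p)
                       (ℤₚ.*-identityˡ 1ℤ) (cong (λ c → + c * x ℤ.^ p) (nCn≡1 p) ⟨ trans ⟩ ℤₚ.*-identityˡ (x ℤ.^ p)) p∣t
    expansion : (1ℤ + x) ℤ.^ p - (1ℤ + x) ≡ ∑[ i < suc p ] t i - (1ℤ + x ℤ.^ p) + (x ℤ.^ p - x)
    expansion = cong (_- (1ℤ + x)) (binomial x p) ⟨ trans ⟩ lemma (∑[ i < suc p ] t i) (x ℤ.^ p) x
      where lemma : ∀ s y x → s - (1ℤ + x) ≡ s - (1ℤ + y) + (y - x)
            lemma = solve-∀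

  -- Stirling's expansion of kᵖ for k < p: modulo p only the terms j = 1 and j = k survive (by induction
  -- on k), and kᵖ ≡ k, so p divides S(p, k) k!.
  module _ {k₂ : ℕ} (k<p : suc (suc k₂) < p) (IH : ∀ {j} → j < suc (suc k₂) → 2 ≤ j → p ℕᵈ.∣ S p j) where
    private
      k : ℕ
      k = suc (suc k₂)
      f t v : ℕ → ℤ
      f = falling-ℤ (+ k)
      t j = + S p j * f j
      v j = + S p k * f j

      p∣t : ∀ j → j ≢ 1 → j ≢ k → + p ∣ t j
      p∣t j j≢1 j≢k with ℕₚ.<-cmp j k
      ... | tri≈ _ j≡k _ = contradiction j≡k j≢k
      ... | tri> _ _ j>k = subst (+ p ∣_) (sym (cong (+ S p j *_) (falling-ℤ-beyond j>k) ⟨ trans ⟩ ℤₚ.*-zeroʳ (+ S p j))) ∣0ℤ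
      ... | tri< j<k _ _ with j
      ...   | zero          = subst (+ p ∣_) (sym (cong (λ s → + s * 1ℤ) (S-zero 0<p))) ∣0ℤ
      ...   | suc zero      = contradiction refl j≢1
      ...   | suc (suc j₂)  = ∣m⇒∣m*n {m = + S p (suc (suc j₂))} (f (suc (suc j₂))) (∣ᵤ⇒∣ (IH j<k (s≤s (s≤s z≤n))))

      p∣∑t : + p ∣ ∑[ j < suc p ] t j - (f 1 + v k)
      p∣∑t = ∑-mod-two-terms t f v (suc p) (s≤s (ℕₚ.<⇒≤ p>1)) (ℕₚ.<-trans k<p (ℕₚ.n<1+n p)) (λ ()) t₁ refl p∣t
        where t₁ : t 1 ≡ f 1
              t₁ = cong (λ s → + s * f 1) (S-one 0<p) ⟨ trans ⟩ ℤₚ.*-identityˡ (f 1)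

    p∣S·k! : p ℕᵈ.∣ S p k ℕ.* k !
    p∣S·k! = ∣⇒∣ᵤ (subst (+ p ∣_) identity (∣m∣n⇒∣m-n (fermat (suc k₂)) p∣∑t))
      where
      identity : (+ k) ℤ.^ p - + k - (∑[ j < suc p ] t j - (f 1 + v k)) ≡ + (S p k ℕ.* k !)
      identity = cong₂ (λ w z → (+ k) ℤ.^ p - + k - (w - (z + v k))) (sym (stirling-ℤ (+ k) p)) (f₁ (+ k)) ⟨ trans ⟩
                 cancel ((+ k) ℤ.^ p) (+ k) (v k) ⟨ trans ⟩
                 cong (+ S p k *_) (falling-ℤ-diagonal k) ⟨ trans ⟩ sym (ℤₚ.pos-* (S p k) (k !))
        where
        f₁ : ∀ a → 1ℤ * (a - 0ℤ) ≡ a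
        f₁ = solve-∀
        cancel : ∀ y a c → y - a - (y - (a + c)) ≡ c
        cancel = solve-∀

  p∣S[p,k] : ∀ k → 2 ≤ k → k < p → p ℕᵈ.∣ S p k
  p∣S[p,k] = <-rec (λ k → 2 ≤ k → k < p → p ℕᵈ.∣ S p k) step
    where
    step : ∀ k → (∀ {j} → j < k → 2 ≤ j → j < p → p ℕᵈ.∣ S p j) → 2 ≤ k → k < p → p ℕᵈ.∣ S p k
    step (suc zero)     _  (s≤s ()) _
    step (suc (suc k₂)) IH _        k<p =
      ∣m*n∧∤n⇒∣m (p∣S·k! k<p (λ j<k 2≤j → IH j<k 2≤j (ℕₚ.<-trans j<k k<p))) (p∤m! k<p)

  S-mod-p : ∀ j → + p ∣ + S p j - (δ 1 j * 1ℤ + δ p j * 1ℤ)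
  S-mod-p = δ-pattern (+_ ∘ S p) (λ _ → 1ℤ) (λ _ → 1ℤ) (ℕₚ.<⇒≢ p>1) (cong +_ (S-one 0<p)) (cong +_ (S-diagonal p)) middle
    where
    middle : ∀ j → j ≢ 1 → j ≢ p → + p ∣ + S p j
    middle j j≢1 j≢p with ℕₚ.<-cmp j p
    ... | tri≈ _ j≡p _ = contradiction j≡p j≢p
    ... | tri> _ _ j>p = subst (+ p ∣_) (sym (cong +_ (S-beyond j>p))) ∣0ℤ
    ... | tri< j<p _ _ with j
    ...   | zero         = subst (+ p ∣_) (sym (cong +_ (S-zero 0<p))) ∣0ℤ
    ...   | suc zero     = contradiction refl j≢1
    ...   | suc (suc j₂) = ∣ᵤ⇒∣ (p∣S[p,k] (suc (suc j₂)) (s≤s (s≤s z≤n)) j<p)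


module PowersOfJ (p : ℕ) where

  open import Data.Integer.Base using (+_)
  open PolynomialOperators

  g : P
  g = falling X p ⊹ 1P

  open IdealPowers ℙ (C (+ p)) g public


module Vanishing (p : ℕ) (sgn-p : sgn p ≡ -1ℤ) where

  open import Data.Nat.Base as ℕ using (zero; suc; _≤_; _∸_; ⌈_/2⌉)
  import Data.Nat.Properties as ℕₚ
  import Data.Nat.Divisibility as ℕᵈ
  open import Data.Integer.Base using (ℤ; +_; 1ℤ; -1ℤ; _+_; _*_; -_; _-_)
  import Data.Integer.Properties as ℤₚ
  open import Data.Integer.Divisibility.Signed using (_∣_; divides; ∣ᵤ⇒∣; ∣-trans; ∣m∣n⇒∣m+n; ∣m∣n⇒∣m-n; ∣m⇒∣-m)
  open import Data.Integer.Tactic.RingSolver using (solve-∀)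
  open import Data.Product.Base using (Σ; _,_; _×_)
  open import Function.Base using (_∘_; _⟨_⟩_)
  open import Relation.Binary.PropositionalEquality
  open IntegerSums
  open PolynomialOperators
  open ComplementaryBellFunctional
  open PowersOfJ p
  open CommutativeRing ℙ using () renaming (refl to ≈-refl; sym to ≈-sym)

  g-ψ : ∀ n → ⟦ g ⟧ ψ n ≡ ψ n - T^ p ψ n
  g-ψ n = cong (_+ 1ℤ * ψ n) (falling-ψ p n ⟨ trans ⟩ cong (_* T^ p ψ n) sgn-p) ⟨ trans ⟩ lemma (ψ n) (T^ p ψ n)
    where lemma : ∀ a b → -1ℤ * b + 1ℤ * a ≡ a - b
          lemma = solve-∀

  g-action : ∀ {y y′} → DifferenceQuotient p y y′ → ∀ n →
             ⟦ g ⊙ y ⟧ ψ n ≡ ⟦ y ⟧ ψ n - T^ p (⟦ y ⟧ ψ) n - + p * T^ p (⟦ y′ ⟧ ψ) n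
  g-action {y} {y′} dq n = begin
    ⟦ g ⟧ (⟦ y ⟧ ψ) n
      ≡⟨ ⟦⟧-comm g y ψ n ⟩
    ⟦ y ⟧ (⟦ g ⟧ ψ) n
      ≡⟨ ⟦⟧.cong-≗ y (λ m → g-ψ m ⟨ trans ⟩ cong (_+_ (ψ m)) (sym (ℤₚ.-1*i≡-i _))) n ⟩
    ⟦ y ⟧ (λ m → ψ m + -1ℤ * T^ p ψ m) n
      ≡⟨ ⟦⟧.+-*-homo y ψ -1ℤ (T^ p ψ) n ⟩
    ⟦ y ⟧ ψ n + -1ℤ * ⟦ y ⟧ (T^ p ψ) n
      ≡⟨ cong (λ v → ⟦ y ⟧ ψ n + -1ℤ * v) (law dq ψ n ⟨ trans ⟩ T^.+-*-homo p (⟦ y ⟧ ψ) (+ p) (⟦ y′ ⟧ ψ) n) ⟩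
    ⟦ y ⟧ ψ n + -1ℤ * (T^ p (⟦ y ⟧ ψ) n + + p * T^ p (⟦ y′ ⟧ ψ) n)
      ≡⟨ lemma (⟦ y ⟧ ψ n) (T^ p (⟦ y ⟧ ψ) n) (+ p) (T^ p (⟦ y′ ⟧ ψ) n) ⟩
    ⟦ y ⟧ ψ n - T^ p (⟦ y ⟧ ψ) n - + p * T^ p (⟦ y′ ⟧ ψ) n
      ∎
    where
    open ≡-Reasoning
    lemma : ∀ a b c d → a + -1ℤ * (b + c * d) ≡ a - b - c * d
    lemma = solve-∀

  ∈J-lower : ∀ {k x} → x ∈J^ suc (k ∸ 1) → x ∈J^ k
  ∈J-lower {k} = ∈J-≤ (ℕₚ.m≤n+m∸n k 1)

  diffQuot-∈J : ∀ {k y} → y ∈J^ k → Σ P λ y′ → y′ ∈J^ (k ∸ 1) × DifferenceQuotient p y y′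
  diffQuot-∈J (J⁰ y) with diffQuot p y
  ... | y′ , dq = y′ , J⁰ y′ , dq
  diffQuot-∈J {suc k} (J-gen {x = x} {y} x∈J y∈J z≈) with diffQuot-∈J x∈J | diffQuot-∈J y∈J | diffQuot p g
  ... | x′ , x′∈J , dqx | y′ , y′∈J , dqy | g′ , dqg =
    B , B∈J , dq-resp (≈-sym z≈) ≈-refl (dq-⊹ (dq-⊙ (dq-C (+ p)) dqx) (dq-⊙ dqg dqy))
    where
    B : P
    B = 0P ⊙ (x ⊹ C (+ p) ⊙ x′) ⊹ C (+ p) ⊙ x′ ⊹ (g′ ⊙ (y ⊹ C (+ p) ⊙ y′) ⊹ g ⊙ y′)
    B∈J : B ∈J^ k
    B∈J = ∈J-+ (∈J-+ (∈J-*ʳ _ (0∈J k)) (∈J-lower (π*∈J x′∈J)))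
               (∈J-+ (∈J-*ˡ g′ (∈J-+ y∈J (∈J-lower (π*∈J y′∈J)))) (∈J-lower (γ*∈J y′∈J)))

  p^ : ℕ → ℤ
  p^ e = + (p ℕ.^ e)

  p^-suc : ∀ e → p^ (suc e) ≡ + p * p^ e
  p^-suc e = ℤₚ.pos-* p (p ℕ.^ e)

  p^-mono : ∀ {e e′} → e ≤ e′ → p^ e ∣ p^ e′
  p^-mono {e} {e′} e≤e′ = ∣ᵤ⇒∣ (ℕᵈ.divides (p ℕ.^ (e′ ∸ e))
    (cong (p ℕ.^_) (sym (ℕₚ.m∸n+n≡m e≤e′)) ⟨ trans ⟩ ℕₚ.^-distribˡ-+-* p (e′ ∸ e) e))

  vanishing-step : ∀ k {x y y′ z} → z ≈ C (+ p) ⊙ x ⊹ g ⊙ y →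
               (∀ n → p^ ⌈ k /2⌉ ∣ ⟦ x ⟧ ψ n) → (∀ n → p^ ⌈ k /2⌉ ∣ ⟦ y ⟧ ψ n) →
               DifferenceQuotient p y y′ → (∀ n → p^ ⌈ k ∸ 1 /2⌉ ∣ ⟦ y′ ⟧ ψ n) →
               ∀ n → p^ (suc ⌈ k ∸ 1 /2⌉) ∣ ⟦ z ⟧ ψ n
  vanishing-step k {x} {y} {y′} z≈ p∣x p∣y dq p∣y′ n =
    subst₂ _∣_ (sym (p^-suc e)) (sym (run z≈ ψ n))
      (∣m∣n⇒∣m+n x-part (subst (+ p * p^ e ∣_) (sym (g-action dq n)) (∣m∣n⇒∣m-n y-part y′-part)))
    where
    e : ℕ
    e = ⌈ k ∸ 1 /2⌉
    weaken : ∀ {v} → p^ ⌈ k /2⌉ ∣ v → p^ e ∣ v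
    weaken = ∣-trans (p^-mono (ℕₚ.⌈n/2⌉-mono (ℕₚ.m∸n≤m k 1)))
    x-part : + p * p^ e ∣ + p * ⟦ x ⟧ ψ n
    x-part = *-monoˡ-∣ (+ p) (weaken (p∣x n))
    y-part : + p * p^ e ∣ ⟦ y ⟧ ψ n - T^ p (⟦ y ⟧ ψ) n
    y-part = subst (+ p * p^ e ∣_) (negate (T^ p (⟦ y ⟧ ψ) n) (⟦ y ⟧ ψ n)) (∣m⇒∣-m (T^-congruence p (weaken ∘ p∣y) n))
      where negate : ∀ a b → - (a - b) ≡ b - a
            negate = solve-∀
    y′-part : + p * p^ e ∣ + p * T^ p (⟦ y′ ⟧ ψ) n
    y′-part = *-monoˡ-∣ (+ p) (T^-preserves-∣ p p∣y′ n)

  vanishing : ∀ k {y} → y ∈J^ k → ∀ n → p^ ⌈ k /2⌉ ∣ ⟦ y ⟧ ψ n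
  vanishing zero          (J⁰ y)             n = divides (⟦ y ⟧ ψ n) (sym (ℤₚ.*-identityʳ _))
  vanishing (suc zero)    (J-gen x∈J y∈J z≈) =
    let y′ , y′∈J , dq = diffQuot-∈J y∈J
    in  vanishing-step zero z≈ (vanishing zero x∈J) (vanishing zero y∈J) dq (vanishing zero y′∈J)
  vanishing (suc (suc k)) (J-gen x∈J y∈J z≈) =
    let y′ , y′∈J , dq = diffQuot-∈J y∈J
    in  vanishing-step (suc k) z≈ (vanishing (suc k) x∈J) (vanishing (suc k) y∈J) dq (vanishing k y′∈J)


module PowersOfX (p : ℕ) (p-prime : Prime p) where

  open import Data.Nat.Base as ℕ using (zero; suc; s≤s)
  import Data.Nat.Properties as ℕₚ
  import Data.Nat.Tactic.RingSolver as ℕ-Solver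
  open import Data.Integer.Base using (ℤ; +_; 0ℤ; 1ℤ; -1ℤ; _+_; _*_; -_; _-_)
  import Data.Integer.Properties as ℤₚ
  open import Data.Integer.Divisibility.Signed using (_∣_; quotient)
  open import Data.Integer.Tactic.RingSolver using (solve-∀)
  open import Function.Base using (_⟨_⟩_)
  open import Relation.Binary.PropositionalEquality
  import Relation.Binary.Reasoning.Setoid as SetoidReasoning
  open import Defs using (S)
  open IntegerSums
  open PolynomialOperators
  open StirlingExpansion
  open PrimeCongruences p p-prime
  open PowersOfJ p
  open CommutativeRing ℙ using (*-identityʳ) renaming (refl to ≈-refl; sym to ≈-sym; trans to ≈-trans)
  open import Algebra.Properties.CommutativeSemiring.Exp (CommutativeRing.commutativeSemiring ℙ) using (_^_; ^-congʳ; ^-assocʳ; ^-homo-*)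

  π∈J : C (+ p) ∈J^ 1
  π∈J = ∈J-resp (*-identityʳ (C (+ p))) (π*∈J (J⁰ 1P))

  p×1∈J : p ℙ-Mult.× 1P ∈J^ 1
  p×1∈J = ∈J-resp (≈-sym (×1P≈C p)) π∈J

  g∈J : g ∈J^ 1
  g∈J = ∈J-resp (*-identityʳ g) (γ*∈J (J⁰ 1P))

  stirling-mod-p : ∀ Y → Y ^ p ≡ Y ⊹ falling Y p modJ^ 1
  stirling-mod-p Y = mk≡ (π*∈J (J⁰ R)) (mk≈ expansion)
    where
    q : ℕ → ℤ
    q j = quotient (S-mod-p j)
    R : P
    R = ∑ᴾ (suc p) (λ j → C (q j) ⊙ falling Y j)
    expansion : ∀ s m → ⟦ Y ^ p ⟧ s m ≡ ⟦ Y ⊹ falling Y p ⊹ C (+ p) ⊙ R ⟧ s m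
    expansion s m = begin
      ⟦ Y ^ p ⟧ s m
        ≡⟨ stirling Y p s m ⟩
      ∑[ j < suc p ] (+ S p j * y j)
        ≡⟨ ∑-cong split (suc p) ⟩
      ∑[ j < suc p ] (+ p * (q j * y j) + (δ 1 j * y j + δ p j * y j))
        ≡⟨ ∑-distrib-+ (λ j → + p * (q j * y j)) (λ j → δ 1 j * y j + δ p j * y j) (suc p) ⟩
      ∑[ j < suc p ] (+ p * (q j * y j)) + ∑[ j < suc p ] (δ 1 j * y j + δ p j * y j)
        ≡⟨ cong₂ _+_ (∑-distribˡ-* (+ p) (λ j → q j * y j) (suc p)) (∑-δ₂ y y (suc p) 1<1+p (ℕₚ.n<1+n p)) ⟩
      + p * ∑[ j < suc p ] (q j * y j) + (y 1 + y p)
        ≡⟨ cong₂ (λ a b → + p * a + (b + y p)) (sym (⟦∑ᴾ⟧ (suc p) (λ j → C (q j) ⊙ falling Y j) s m)) (falling-1 Y s m) ⟩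
      + p * ⟦ R ⟧ s m + (⟦ Y ⟧ s m + y p)
        ≡⟨ ℤₚ.+-comm (+ p * ⟦ R ⟧ s m) _ ⟩
      ⟦ Y ⊹ falling Y p ⊹ C (+ p) ⊙ R ⟧ s m
        ∎
      where
      open ≡-Reasoning
      y : ℕ → ℤ
      y j = ⟦ falling Y j ⟧ s m
      1<1+p : 1 ℕ.< suc p
      1<1+p = s≤s (ℕₚ.<⇒≤ p>1)
      split : ∀ j → + S p j * y j ≡ + p * (q j * y j) + (δ 1 j * y j + δ p j * y j)
      split j = cong (_* y j) (lemma₁ (+ S p j) _ _ (_∣_.equality (S-mod-p j))) ⟨ trans ⟩ lemma₂ (q j) (+ p) (δ 1 j) (δ p j) (y j)
        where
        lemma₁ : ∀ s e r → s - e ≡ r → s ≡ r + e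
        lemma₁ s e r refl = sym (cancel s e)
          where cancel : ∀ s e → s - e + e ≡ s
                cancel = solve-∀
        lemma₂ : ∀ q p a b y → (q * p + (a * 1ℤ + b * 1ℤ)) * y ≡ p * (q * y) + (a * y + b * y)
        lemma₂ = solve-∀

  falling-p-shift : ∀ Y → falling (Y ⊹ 1P) p ≡ falling Y p modJ^ 1
  falling-p-shift Y = mk≡ (π*∈J (J⁰ _))
    (subst (λ k → falling (Y ⊹ 1P) k ≈ falling Y k ⊹ C (+ k) ⊙ falling Y (ℕ.pred p))
           (ℕₚ.suc-pred p {{ℕ.>-nonZero (ℕₚ.<-trans ℕₚ.0<1+n p>1)}})
           (falling-difference Y (ℕ.pred p)))

  falling-X-shift : ∀ k → falling (X ⊹ C (- + k)) p ≡ falling X p modJ^ 1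
  falling-X-shift zero    = ≈⇒≡ (falling-cong (mk≈ λ s n → ℤₚ.+-identityʳ (⟦ X ⟧ s n)) p)
  falling-X-shift (suc k) = begin
    falling (X ⊹ C (- + suc k)) p       ≈⟨ ≡-sym (falling-p-shift (X ⊹ C (- + suc k))) ⟩
    falling (X ⊹ C (- + suc k) ⊹ 1P) p  ≈⟨ ≈⇒≡ (falling-cong (mk≈ λ s n → lemma (⟦ X ⟧ s n) (+ k) (s n)) p) ⟩
    falling (X ⊹ C (- + k)) p           ≈⟨ falling-X-shift k ⟩
    falling X p                         ∎
    where
    open SetoidReasoning (≡-setoid 1)
    lemma : ∀ a k x → a + - (1ℤ + k) * x + 1ℤ * x ≡ a + - k * x
    lemma = solve-∀

  falling-X-p≡-1 : falling X p ≡ ⊖ 1P modJ^ 1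
  falling-X-p≡-1 = mk≡ g∈J (solve 1 (λ x → x := :- con 1ℤ :+ (x :+ con 1ℤ)) ≈-refl (falling X p))
    where open ℙ-Solver

  ^-comm-assoc : ∀ y m n → y ^ (n ℕ.* m) ≈ (y ^ m) ^ n
  ^-comm-assoc y m n = ≈-trans (^-congʳ y (ℕₚ.*-comm n m)) (≈-sym (^-assocʳ y m n))

  X^p^k : ∀ k → X ^ (p ℕ.^ k) ≡ X ⊹ C (- + k) modJ^ 1
  X^p^k zero    = ≈⇒≡ (mk≈ λ s n → lemma (s (suc n)) (+ n) (s n))
    where lemma : ∀ a k x → 1ℤ * a + k * (1ℤ * x) ≡ a + k * x + 0ℤ * x
          lemma = solve-∀
  X^p^k (suc k) = begin
    X ^ (p ℕ.* p ℕ.^ k)                            ≈⟨ ≈⇒≡ (^-comm-assoc X (p ℕ.^ k) p) ⟩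
    (X ^ (p ℕ.^ k)) ^ p                            ≈⟨ ≡-^ (X^p^k k) p ⟩
    (X ⊹ C (- + k)) ^ p                            ≈⟨ stirling-mod-p (X ⊹ C (- + k)) ⟩
    X ⊹ C (- + k) ⊹ falling (X ⊹ C (- + k)) p      ≈⟨ ≡-+ ≡-refl (falling-X-shift k) ⟩
    X ⊹ C (- + k) ⊹ falling X p                    ≈⟨ ≡-+ ≡-refl falling-X-p≡-1 ⟩
    X ⊹ C (- + k) ⊹ ⊖ 1P                           ≈⟨ ≈⇒≡ (mk≈ λ s n → lemma (⟦ X ⟧ s n) (+ k) (s n)) ⟩
    X ⊹ C (- + suc k)                              ∎
    where
    open SetoidReasoning (≡-setoid 1)
    lemma : ∀ a k x → a + - k * x + -1ℤ * (1ℤ * x) ≡ a + - (1ℤ + k) * x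
    lemma = solve-∀

  X^repunit : ∀ m → X ^ repunit p m ≡ falling X m modJ^ 1
  X^repunit zero    = ≡-refl
  X^repunit (suc m) = ≡-trans (≈⇒≡ (^-homo-* X (repunit p m) (p ℕ.^ m))) (≡-* (X^repunit m) (X^p^k m))

  X^2N : X ^ (2 ℕ.* repunit p p) ≡ 1P modJ^ 1
  X^2N = begin
    X ^ (2 ℕ.* repunit p p)   ≈⟨ ≈⇒≡ (^-comm-assoc X (repunit p p) 2) ⟩
    (X ^ repunit p p) ^ 2     ≈⟨ ≡-^ (≡-trans (X^repunit p) falling-X-p≡-1) 2 ⟩
    (⊖ 1P) ^ 2                ≈⟨ ≈⇒≡ (solve 0 (:- con 1ℤ :* (:- con 1ℤ :* con 1ℤ) := con 1ℤ) ≈-refl) ⟩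
    1P                        ∎
    where
    open SetoidReasoning (≡-setoid 1)
    open ℙ-Solver

  X^2Np^j : ∀ j → X ^ (2 ℕ.* repunit p p ℕ.* p ℕ.^ j) ≡ 1P modJ^ suc j
  X^2Np^j zero    = ≡-trans (≈⇒≡ (^-congʳ X (ℕₚ.*-identityʳ (2 ℕ.* repunit p p)))) X^2N
  X^2Np^j (suc j) = ≡-trans (≈⇒≡ (≈-trans (^-congʳ X exponent) (^-comm-assoc X (2 ℕ.* repunit p p ℕ.* p ℕ.^ j) p)))
                            (^-lift p p×1∈J (X^2Np^j j))
    where
    exponent : 2 ℕ.* repunit p p ℕ.* (p ℕ.* p ℕ.^ j) ≡ p ℕ.* (2 ℕ.* repunit p p ℕ.* p ℕ.^ j)
    exponent = reorder (2 ℕ.* repunit p p) p (p ℕ.^ j)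
      where reorder : ∀ a b c → a ℕ.* (b ℕ.* c) ≡ b ℕ.* (a ℕ.* c)
            reorder = ℕ-Solver.solve-∀


module Periodicity (p : ℕ) (p-prime : Prime p) (sgn-p : sgn p ≡ -1ℤ) where

  open import Data.Nat.Base as ℕ using (suc; ⌈_/2⌉)
  open import Data.Integer.Base using (1ℤ; _+_; -_; _-_)
  open import Data.Integer.Divisibility.Signed using (_∣_; ∣m⇒∣-m)
  open import Data.Integer.Tactic.RingSolver using (solve-∀)
  open import Function.Base using (_⟨_⟩_)
  open import Relation.Binary.PropositionalEquality
  open import Defs using (f)
  open IntegerSums using (repunit)
  open PolynomialOperators
  open ComplementaryBellFunctional
  open PowersOfJ p
  open Vanishing p sgn-p
  open PowersOfX p p-prime
  open CommutativeRing ℙ using (*-cong) renaming (refl to ≈-refl; trans to ≈-trans)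
  open import Algebra.Properties.CommutativeSemiring.Exp (CommutativeRing.commutativeSemiring ℙ) using (_^_; ^-homo-*)

  f-congruence : ∀ j n → p^ ⌈ suc j /2⌉ ∣ f n - f (n ℕ.+ 2 ℕ.* repunit p p ℕ.* p ℕ.^ j)
  f-congruence j n = from-congruence (X^2Np^j j)
    where
    period : ℕ
    period = 2 ℕ.* repunit p p ℕ.* p ℕ.^ j
    from-congruence : X ^ period ≡ 1P modJ^ suc j → p^ ⌈ suc j /2⌉ ∣ f n - f (n ℕ.+ period)
    from-congruence (mk≡ {d} d∈J X^period≈1+d) =
      subst (p^ ⌈ suc j /2⌉ ∣_) (sym difference) (∣m⇒∣-m (vanishing (suc j) (∈J-*ˡ (X ^ n) d∈J) 0))
      where
      open ℙ-Solver
      split : X ^ (n ℕ.+ period) ≈ X ^ n ⊹ X ^ n ⊙ d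
      split = ≈-trans (^-homo-* X n period)
             (≈-trans (*-cong ≈-refl X^period≈1+d) (solve 2 (λ a e → a :* (con 1ℤ :+ e) := a :+ a :* e) ≈-refl (X ^ n) d))
      difference : f n - f (n ℕ.+ period) ≡ - ⟦ X ^ n ⊙ d ⟧ ψ 0
      difference = cong₂ _-_ (f≡⟦X^n⟧ψ n) (f≡⟦X^n⟧ψ (n ℕ.+ period) ⟨ trans ⟩ run split ψ 0) ⟨ trans ⟩
                   lemma (⟦ X ^ n ⟧ ψ 0) (⟦ X ^ n ⊙ d ⟧ ψ 0)
        where lemma : ∀ a b → a - (a + b) ≡ - b
              lemma = solve-∀


open import Defs
open import Data.Nat using (ℕ; suc; _+_; _*_; _∸_; _^_; _≥_)
open import Data.Nat.Divisibility using (_∣_)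
open import Data.Nat.Primality using (Prime)
open import Data.Product using (_×_)
open import Relation.Nullary using (¬_)
open import Data.Nat.Base using (zero; ⌊_/2⌋; ⌈_/2⌉; NonZero)
import Data.Nat.Properties as ℕₚ
import Data.Nat.Tactic.RingSolver as ℕ-Solver
open import Data.Nat.Divisibility using (divides; ∣-refl; ∣m∣n⇒∣m+n)
open import Data.Nat.DivMod using (_/_; m*n/n≡m)
open import Data.Nat.Primality using (prime⇒nonZero)
import Data.Integer.Properties as ℤₚ
open import Data.Integer.Divisibility.Signed using (∣⇒∣ᵤ)
open import Data.Product using (_,_)
open import Function.Base using (_⟨_⟩_)
open import Relation.Nullary.Negation using (contradiction)
open import Relation.Binary.PropositionalEquality using (refl; sym; trans; cong; cong₂; subst₂; module ≡-Reasoning)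
open IntegerSums using (repunit; repunit-closed-form)

sgn-odd : ∀ n → ¬ 2 ∣ n → sgn n ≡ -1ℤ
sgn-odd zero          2∤n = contradiction (divides 0 refl) 2∤n
sgn-odd (suc zero)    _   = refl
sgn-odd (suc (suc n)) 2∤n = ℤₚ.neg-involutive (sgn n) ⟨ trans ⟩ sgn-odd n (λ 2∣n → 2∤n (∣m∣n⇒∣m+n ∣-refl 2∣n))

p^p∸1≡repunit*[p∸1] : ∀ p → .{{NonZero p}} → p ^ p ∸ 1 ≡ repunit p p * (p ∸ 1)
p^p∸1≡repunit*[p∸1] p@(suc p₁) =
  cong (_∸ 1) (sym (repunit-closed-form p₁ p)) ⟨ trans ⟩
  ℕₚ.m+n∸n≡m (p₁ * repunit p p) 1 ⟨ trans ⟩ ℕₚ.*-comm p₁ (repunit p p)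

module _ (p : ℕ) (pp : Prime p) where

  private instance
    p≢0 : NonZero p
    p≢0 = prime⇒nonZero pp
    p∸1≢0 : NonZero (p ∸ 1)
    p∸1≢0 = pred-nonZero p pp

  period-mod-p : 2 * repunit p p * p ^ 0 ≡ 2 * ((p ^ p ∸ 1) /[p-1] p) {pp}
  period-mod-p = ℕₚ.*-identityʳ (2 * repunit p p) ⟨ trans ⟩ cong (2 *_) (sym (begin
    (p ^ p ∸ 1) / (p ∸ 1)                ≡⟨ cong (_/ (p ∸ 1)) (p^p∸1≡repunit*[p∸1] p) ⟩
    (repunit p p * (p ∸ 1)) / (p ∸ 1)    ≡⟨ m*n/n≡m (repunit p p) (p ∸ 1) ⟩
    repunit p p                          ∎))
    where open ≡-Reasoning

  period-mod-p^h : ∀ h → 2 * repunit p p * p ^ (2 * h) ≡ ((2 * p ^ (2 * suc h ∸ 2) * (p ^ p ∸ 1)) /[p-1] p) {pp}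
  period-mod-p^h h = sym (begin
    (2 * p ^ (2 * suc h ∸ 2) * (p ^ p ∸ 1)) / (p ∸ 1)
      ≡⟨ cong₂ (λ e x → (2 * p ^ e * x) / (p ∸ 1)) (cong (_∸ 2) (ℕₚ.*-suc 2 h)) (p^p∸1≡repunit*[p∸1] p) ⟩
    (2 * p ^ (2 * h) * (repunit p p * (p ∸ 1))) / (p ∸ 1)
      ≡⟨ cong (_/ (p ∸ 1)) (sym (ℕₚ.*-assoc (2 * p ^ (2 * h)) (repunit p p) (p ∸ 1))) ⟩
    (2 * p ^ (2 * h) * repunit p p * (p ∸ 1)) / (p ∸ 1)
      ≡⟨ m*n/n≡m (2 * p ^ (2 * h) * repunit p p) (p ∸ 1) ⟩
    2 * p ^ (2 * h) * repunit p p
      ≡⟨ swap (p ^ (2 * h)) (repunit p p) ⟩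
    2 * repunit p p * p ^ (2 * h)
      ∎)
    where
    open ≡-Reasoning
    swap : ∀ x y → 2 * x * y ≡ 2 * y * x
    swap = ℕ-Solver.solve-∀

⌈1+2h/2⌉≡1+h : ∀ h → ⌈ suc (2 * h) /2⌉ ≡ suc h
⌈1+2h/2⌉≡1+h h = cong suc (cong ⌊_/2⌋ (cong (h +_) (ℕₚ.+-identityʳ h)) ⟨ trans ⟩ sym (ℕₚ.n≡⌊n+n/2⌋ h))

proposition3p1 : (p : ℕ) → (pp : Prime p) → ¬ (2 ∣ p) →
    ((n : ℕ) → f n ≡ f (n + 2 * ((p ^ p ∸ 1) /[p-1] p) {pp}) [mod p ])
    × ((n h : ℕ) → h ≥ 1 →
        f n ≡ f (n + ((2 * p ^ (2 * h ∸ 2) * (p ^ p ∸ 1)) /[p-1] p) {pp}) [mod p ^ h ])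
proposition3p1 p pp 2∤p = mod-p , mod-p^h
  where
  open Periodicity p pp (sgn-odd p 2∤p) using (f-congruence)
  mod-p : (n : ℕ) → f n ≡ f (n + 2 * ((p ^ p ∸ 1) /[p-1] p) {pp}) [mod p ]
  mod-p n = subst₂ (λ T m → f n ≡ f (n + T) [mod m ]) (period-mod-p p pp) (ℕₚ.*-identityʳ p)
                   (∣⇒∣ᵤ (f-congruence 0 n))
  mod-p^h : (n h : ℕ) → h ≥ 1 → f n ≡ f (n + ((2 * p ^ (2 * h ∸ 2) * (p ^ p ∸ 1)) /[p-1] p) {pp}) [mod p ^ h ]
  mod-p^h n (suc h) _ = subst₂ (λ T m → f n ≡ f (n + T) [mod p ^ m ]) (period-mod-p^h p pp h) (⌈1+2h/2⌉≡1+h h)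
                               (∣⇒∣ᵤ (f-congruence (2 * h) n))
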